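{- Let $k_\mathcal{G}=n_\mathcal{G}\ge1$ and $k_\mathcal{H}=n_\mathcal{H}-d\ge1$ for some integer $d\ge1$, let $g\in V(\mathcal{G})$ and let $j$ be a non-negative integer. Then $\sigma_{d+j+1}(g)\equiv\binom{n_\mathcal{H}}{d+j+1}\sum_{r=0}^{d}\frac{\binom{d+1}{r}}{\binom{n_\mathcal{H}}{j+r}}(-1)^{d+r}\sigma_{j+r}(g)\pmod{I_{\mathrm{viz}}}$.
   Context: $\mathbb{K}$ is a subfield of $\mathbb{R}$. $V(\mathcal{G})$ is a set of $n_\mathcal{G}$ vertices with fixed subset $D_\mathcal{G}$ of size $k_\mathcal{G}$; $V(\mathcal{H})$ a disjoint set of $n_\mathcal{H}$ vertices with fixed subset $D_\mathcal{H}$ of size $k_\mathcal{H}$. Variables $e_{gg'}=e_{g'g}$ for 2-subsets of $V(\mathcal{G})$, $e_{hh'}$ for 2-subsets of $V(\mathcal{H})$, $x_{gh}$ for $g\in V(\mathcal{G}),h\in V(\mathcal{H})$; $P$ is the polynomial ring over $\mathbb{K}$ in these. $I_{\mathrm{viz}}\subseteq P$ is generated by: $e_{gg'}^2-e_{gg'}$; $\prod_{g'\in D_\mathcal{G}}(1-e_{gg'})$ for $g\in V(\mathcal{G})\setminus D_\mathcal{G}$; $\prod_{g'\in V(\mathcal{G})\setminus S}\sum_{g\in S}e_{gg'}$ for $S\subseteq V(\mathcal{G})$, $|S|=k_\mathcal{G}-1$; the same three families for $\mathcal{H}$; $x_{gh}^2-x_{gh}$; and $(1-x_{gh})\prod_{g'\ne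 g}(1-e_{gg'}x_{g'h})\prod_{h'\ne h}(1-e_{hh'}x_{gh'})$ for all $g,h$. For $g\in V(\mathcal{G})$ and integer $i\ge0$, $\sigma_i(g)=\sum_{S\subseteq V(\mathcal{H}),\,|S|=i}\prod_{h\in S}x_{gh}$. $a\equiv b\pmod I$ means $a-b\in I$. -}

module Defs where

open import Level using (0ℓ)
open import Algebra.Bundles using (CommutativeRing)
open import Relation.Binary.Structures using (IsStrictTotalOrder)
open import Data.Nat as ℕ using (ℕ; zero; suc)
open import Data.Nat.Combinatorics using (_C_)
open import Data.Fin as Fin using (Fin)
open import Data.Fin.Properties using (<-cmp)
open import Data.Fin.Subset using (Subset; _∈_; _∉_; ∣_∣)
open import Data.Fin.Subset.Properties using (_∈?_)
open import Data.List using (List; []; _∷_; map; foldr; filter; allFin; _++_)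
open import Data.Product using (∃)
open import Relation.Binary.PropositionalEquality using (_≡_)
open import Relation.Nullary using (¬_; ¬?)
open import Relation.Binary.Definitions using (tri<; tri≈; tri>)

-- The coefficient field K.
-- "K is a subfield of ℝ" is rendered as "K is an Archimedean ordered
-- field" (these are exactly the fields isomorphic to subfields of ℝ).
-- The multiplicative inverse is a total operation, specified only on
-- non-zero elements.

ringFromℕ : (R : CommutativeRing 0ℓ 0ℓ) → ℕ → CommutativeRing.Carrier R
ringFromℕ R zero    = CommutativeRing.0# R
ringFromℕ R (suc n) = CommutativeRing._+_ R (CommutativeRing.1# R) (ringFromℕ R n)

record SubfieldOfℝ : Set₁ where
  field
    commutativeRing : CommutativeRing 0ℓ 0ℓ
  open CommutativeRing commutativeRing public
  field
    _⁻¹       : Carrier → Carrier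
    ⁻¹-inverse : ∀ x → ¬ (x ≈ 0#) → (x * (x ⁻¹)) ≈ 1#
    _<_       : Carrier → Carrier → Set
    <-isStrictTotalOrder : IsStrictTotalOrder _≈_ _<_
    0<1       : 0# < 1#
    +-mono-<  : ∀ x y z → x < y → (x + z) < (y + z)
    *-pos     : ∀ x y → 0# < x → 0# < y → 0# < (x * y)
    archimedean : ∀ x → ∃ λ n → x < ringFromℕ commutativeRing n
  fromℕ : ℕ → Carrier
  fromℕ = ringFromℕ commutativeRing

-- all sublists of length i (i.e. all i-element subsets of a list of
-- distinct elements)
choose : ∀ {A : Set} → ℕ → List A → List (List A)
choose zero    xs       = [] ∷ []
choose (suc i) []       = []
choose (suc i) (x ∷ xs) = map (x ∷_) (choose i xs) ++ choose (suc i) xs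

elems : ∀ {n} → Subset n → List (Fin n)
elems {n} S = filter (_∈? S) (allFin n)

nonElems : ∀ {n} → Subset n → List (Fin n)
nonElems {n} S = filter (λ a → ¬? (a ∈? S)) (allFin n)

others : ∀ {n} → Fin n → List (Fin n)
others {n} a = filter (λ b → ¬? (a Fin.≟ b)) (allFin n)

-- Variables. A 2-subset {a,b} is represented by its ordered pair a < b
-- (the order proof is irrelevant, so each 2-subset gives exactly one
-- variable).
data Var (nG nH : ℕ) : Set where
  eG : (a b : Fin nG) → .(a Fin.< b) → Var nG nH
  eH : (a b : Fin nH) → .(a Fin.< b) → Var nG nH
  xv : Fin nG → Fin nH → Var nG nH

module Poly (K : SubfieldOfℝ) (V : Set) where
  open SubfieldOfℝ K using (Carrier; _≈_; _+_; _*_; -_; 0#; 1#)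

  infixl 6 _⊕_ _⊖_
  infixl 7 _⊗_
  data Expr : Set where
    con  : Carrier → Expr
    var  : V → Expr
    _⊕_  : Expr → Expr → Expr
    _⊗_  : Expr → Expr → Expr
    ⊝_   : Expr → Expr

  -- equality in the polynomial ring K[V]: the least congruence making
  -- Expr a commutative K-algebra (so Expr/≋ is the free commutative
  -- K-algebra on V, i.e. the polynomial ring K[V]).
  infix 4 _≋_
  data _≋_ : Expr → Expr → Set where
    ≋-refl  : ∀ {p} → p ≋ p
    ≋-sym   : ∀ {p q} → p ≋ q → q ≋ p
    ≋-trans : ∀ {p q r} → p ≋ q → q ≋ r → p ≋ r
    ⊕-cong  : ∀ {p p' q q'} → p ≋ p' → q ≋ q' → p ⊕ q ≋ p' ⊕ q'
    ⊗-cong  : ∀ {p p' q q'} → p ≋ p' → q ≋ q' → p ⊗ q ≋ p' ⊗ q'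
    ⊝-cong  : ∀ {p p'} → p ≋ p' → ⊝ p ≋ ⊝ p'
    ⊕-assoc : ∀ p q r → (p ⊕ q) ⊕ r ≋ p ⊕ (q ⊕ r)
    ⊕-comm  : ∀ p q → p ⊕ q ≋ q ⊕ p
    ⊕-idʳ   : ∀ p → p ⊕ con 0# ≋ p
    ⊕-invʳ  : ∀ p → p ⊕ (⊝ p) ≋ con 0#
    ⊗-assoc : ∀ p q r → (p ⊗ q) ⊗ r ≋ p ⊗ (q ⊗ r)
    ⊗-comm  : ∀ p q → p ⊗ q ≋ q ⊗ p
    ⊗-idʳ   : ∀ p → p ⊗ con 1# ≋ p
    distribʳ : ∀ p q r → (p ⊕ q) ⊗ r ≋ (p ⊗ r) ⊕ (q ⊗ r)
    con-cong : ∀ {a b} → a ≈ b → con a ≋ con b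
    con-+   : ∀ a b → con (a + b) ≋ con a ⊕ con b
    con-*   : ∀ a b → con (a * b) ≋ con a ⊗ con b
    con--   : ∀ a → con (- a) ≋ ⊝ con a

  data InIdeal (Gen : Expr → Set) : Expr → Set where
    gen  : ∀ {p} → Gen p → InIdeal Gen p
    zero : InIdeal Gen (con 0#)
    add  : ∀ {p q} → InIdeal Gen p → InIdeal Gen q → InIdeal Gen (p ⊕ q)
    mul  : ∀ {p} (h : Expr) → InIdeal Gen p → InIdeal Gen (h ⊗ p)
    resp : ∀ {p q} → p ≋ q → InIdeal Gen p → InIdeal Gen q

  _≡_mod_ : Expr → Expr → (Expr → Set) → Set
  a ≡ b mod Gen = InIdeal Gen (a ⊕ (⊝ b))

  one : Expr
  one = con 1#

  _⊖_ : Expr → Expr → Expr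
  p ⊖ q = p ⊕ (⊝ q)

  Σl : List Expr → Expr
  Σl = foldr _⊕_ (con 0#)

  Πl : List Expr → Expr
  Πl = foldr _⊗_ (con 1#)

module Viz (K : SubfieldOfℝ) (nG nH : ℕ) (DG : Subset nG) (kG : ℕ)
           (DH : Subset nH) (kH : ℕ) where
  open SubfieldOfℝ K using (Carrier; _*_; -_; 0#; 1#; _⁻¹; fromℕ)
  open Poly K (Var nG nH) public

  -- e_{gg'} = e_{g'g} (value on the diagonal is never used)
  eg : Fin nG → Fin nG → Expr
  eg a b with <-cmp a b
  ... | tri< a<b _ _ = var (eG a b a<b)
  ... | tri≈ _ _ _   = con 0#
  ... | tri> _ _ b<a = var (eG b a b<a)

  eh : Fin nH → Fin nH → Expr
  eh a b with <-cmp a b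
  ... | tri< a<b _ _ = var (eH a b a<b)
  ... | tri≈ _ _ _   = con 0#
  ... | tri> _ _ b<a = var (eH b a b<a)

  x : Fin nG → Fin nH → Expr
  x g h = var (xv g h)

  data VizGen : Expr → Set where
    idemG : ∀ a b .(p : a Fin.< b) → VizGen (var (eG a b p) ⊗ var (eG a b p) ⊖ var (eG a b p))
    domG  : ∀ g → g ∉ DG → VizGen (Πl (map (λ g' → one ⊖ eg g g') (elems DG)))
    covG  : ∀ (S : Subset nG) → ∣ S ∣ ≡ kG ℕ.∸ 1 →
            VizGen (Πl (map (λ g' → Σl (map (λ g → eg g g') (elems S))) (nonElems S)))
    idemH : ∀ a b .(p : a Fin.< b) → VizGen (var (eH a b p) ⊗ var (eH a b p) ⊖ var (eH a b p))
    domH  : ∀ h → h ∉ DH → VizGen (Πl (map (λ h' → one ⊖ eh h h') (elems DH)))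
    covH  : ∀ (S : Subset nH) → ∣ S ∣ ≡ kH ℕ.∸ 1 →
            VizGen (Πl (map (λ h' → Σl (map (λ h → eh h h') (elems S))) (nonElems S)))
    idemX : ∀ g h → VizGen (x g h ⊗ x g h ⊖ x g h)
    viz   : ∀ g h → VizGen ((one ⊖ x g h)
                            ⊗ Πl (map (λ g' → one ⊖ eg g g' ⊗ x g' h) (others g))
                            ⊗ Πl (map (λ h' → one ⊖ eh h h' ⊗ x g h') (others h)))

  σ : ℕ → Fin nG → Expr
  σ i g = Σl (map (λ S → Πl (map (x g) S)) (choose i (allFin nH)))

  sign : ℕ → Carrier
  sign zero    = 1#
  sign (suc m) = - sign m

  coeff : ℕ → ℕ → ℕ → Carrier
  coeff d j r = fromℕ (nH C (d ℕ.+ j ℕ.+ 1)) * fromℕ ((d ℕ.+ 1) C r)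
                * (fromℕ (nH C (j ℕ.+ r)) ⁻¹) * sign (d ℕ.+ r)

  sumTo : ℕ → (ℕ → Expr) → Expr
  sumTo zero    f = f 0
  sumTo (suc d) f = sumTo d f ⊕ f (suc d)

  rhs : ℕ → ℕ → Fin nG → Expr
  rhs d j g = sumTo d (λ r → con (coeff d j r) ⊗ σ (j ℕ.+ r) g)

module Submission where

-- Since x² − x ∈ I_viz for every variable x, a polynomial f lies in I_viz as
-- soon as at every 0/1-point α either f(α) = 0 or some element of I_viz is
-- non-zero at α (the indicator polynomials of the points sum to 1).  At a
-- point where the generators vanish, the cover generators of G (k_G = n_G)
-- leave G without edges, so the visibility generators make the set X of h
-- with x_{gh} = 1 dominate H, and the cover generators of H force
-- |X| ≥ n_H − d.  There σ_i(g) evaluates to C(|X|, i) and both sides agree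
-- by a binomial identity for n_H − d ≤ m ≤ n_H, which comes from the
-- vanishing of the (d+1)-st finite difference of a polynomial of degree ≤ d.

open import Data.Nat.Base as Nat using (ℕ; zero; suc)
import Data.Nat.Properties as ℕₚ
open import Data.Nat.Combinatorics as Comb using (_C_)
open import Data.Nat.DivMod using (_/_; m/n*n≡m)
open import Data.Nat.Tactic.RingSolver using (solve-∀)
open import Relation.Binary.PropositionalEquality as ≡ using (_≡_; _≢_)
open import Relation.Nullary using (¬_; ¬?; yes; no)
open import Data.Empty using (⊥-elim)
open import Data.Sum using (_⊎_; inj₁; inj₂)
open import Data.Product using (Σ; _×_; _,_; proj₁; proj₂)
open import Data.Maybe using (Maybe; just; nothing)
import Data.Integer.Base as ℤ
open ℤ using (ℤ)
import Data.Integer.Properties as ℤₚ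
open import Data.Sign.Base as Sign using (Sign)
open import Function using (id; _∘_)
open import Level using (0ℓ)
open import Algebra.Bundles using (CommutativeRing)
open import Algebra.Solver.Ring.AlmostCommutativeRing
  using (fromCommutativeRing; _-Raw-AlmostCommutative⟶_)
import Algebra.Solver.Ring
open import Relation.Binary.Structures using (IsStrictTotalOrder)
open import Relation.Binary.Definitions using (Decidable; DecidableEquality; tri<; tri≈; tri>)
open import Data.Bool.Base using (Bool; true; false; not; if_then_else_)
import Data.Bool.Properties as Boolₚ
open import Data.List.Base as List using (List; []; _∷_)
import Data.List.Properties as ListP
open import Data.Fin.Base as Fin using (Fin)
open import Data.Fin.Subset using (Subset; ∣_∣; inside; outside; ∁; ⁅_⁆) renaming (_∈_ to _∈ˢ_)
import Data.Fin.Subset.Properties as SubsetP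
open import Data.Vec.Base using ([]; _∷_; _[_]=_)
open import Data.List.Membership.Propositional using (_∈_)
open import Data.List.Membership.Propositional.Properties
  using (∈-++⁺ˡ; ∈-++⁺ʳ; ∈-concat⁺′; ∈-cartesianProductWith⁺; ∈-allFin; ∈-filter⁺; ∈-filter⁻)
import Data.Fin.Properties as FinP
import Data.Sum.Properties as Sumₚ
import Data.Product.Properties as Productₚ
open import Relation.Nullary.Decidable using (map′; recompute)
open import Data.List.Relation.Unary.Any using (here; there)
import Relation.Binary.Reasoning.Setoid as SetoidReasoning
open import Defs

module Binomial where
  open ≡ using (refl; sym; trans; cong; cong₂; subst; module ≡-Reasoning)
  open Comb using (nCk≡n!/k![n-k]!; k![n∸k]!∣n!; k>n⇒nCk≡0)
  open Nat using (_+_; _*_; _∸_; _≤_; _<_; _!; NonZero; ≢-nonZero⁻¹)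
  open ℕₚ

  C-factorials : ∀ {n k} → k ≤ n → (n C k) * (k ! * (n ∸ k) !) ≡ n !
  C-factorials {n} {k} k≤n = begin
    (n C k) * (k ! * (n ∸ k) !)                           ≡⟨ cong (_* (k ! * (n ∸ k) !)) (nCk≡n!/k![n-k]! k≤n) ⟩
    (n ! / (k ! * (n ∸ k) !)) {{k !* (n ∸ k) !≢0}} * _    ≡⟨ m/n*n≡m {{k !* (n ∸ k) !≢0}} (k![n∸k]!∣n! k≤n) ⟩
    n ! ∎
    where open ≡-Reasoning

  -- C(n,k) ≠ 0 for k ≤ n, since it divides n! ≠ 0
  C-nonzero : ∀ {n k} → k ≤ n → n C k ≢ 0
  C-nonzero {n} {k} k≤n nCk≡0 = ≢-nonZero⁻¹ (n !) {{n !≢0}} (begin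
    n !                           ≡⟨ C-factorials k≤n ⟨
    (n C k) * (k ! * (n ∸ k) !)   ≡⟨ cong (_* (k ! * (n ∸ k) !)) nCk≡0 ⟩
    0 ∎)
    where open ≡-Reasoning

  -- Choosing an a-set and then a b-set from the rest: the number of ways
  -- times a!·b!·(n∸a∸b)! is n!.
  chooseTwice-factorials : ∀ n a b → a + b ≤ n →
    ((n C a) * ((n ∸ a) C b)) * (a ! * b ! * (n ∸ a ∸ b) !) ≡ n !
  chooseTwice-factorials n a b a+b≤n = begin
    ((n C a) * ((n ∸ a) C b)) * (a ! * b ! * (n ∸ a ∸ b) !)
      ≡⟨ regroup (n C a) ((n ∸ a) C b) (a !) (b !) ((n ∸ a ∸ b) !) ⟩
    (n C a) * (a ! * (((n ∸ a) C b) * (b ! * (n ∸ a ∸ b) !)))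
      ≡⟨ cong (λ z → (n C a) * (a ! * z)) (C-factorials b≤n∸a) ⟩
    (n C a) * (a ! * (n ∸ a) !)
      ≡⟨ C-factorials (≤-trans (m≤m+n a b) a+b≤n) ⟩
    n ! ∎
    where
    open ≡-Reasoning
    regroup : ∀ x y p q r → (x * y) * (p * q * r) ≡ x * (p * (y * (q * r)))
    regroup = solve-∀
    b≤n∸a : b ≤ n ∸ a
    b≤n∸a = subst (_≤ n ∸ a) (m+n∸m≡n a b) (∸-monoˡ-≤ a a+b≤n)

  -- there is no room for disjoint sets of sizes a and b when n < a + b
  chooseTwice-vanishes : ∀ n a b → n < a + b → (n C a) * ((n ∸ a) C b) ≡ 0
  chooseTwice-vanishes n a b n<a+b with a ≤? n
  ... | yes a≤n = trans (cong ((n C a) *_) (k>n⇒nCk≡0 n∸a<b)) (*-zeroʳ (n C a))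
    where
    n∸a<b : n ∸ a < b
    n∸a<b = +-cancelˡ-< a (n ∸ a) b (subst (_< a + b) (sym (m+[n∸m]≡n a≤n)) n<a+b)
  ... | no a≰n = cong (_* ((n ∸ a) C b)) (k>n⇒nCk≡0 (≰⇒> a≰n))

  -- (n C a)·((n−a) C b) is symmetric in a and b: both count the ways of
  -- choosing disjoint sets of sizes a and b.
  chooseTwice-comm : ∀ n a b → (n C a) * ((n ∸ a) C b) ≡ (n C b) * ((n ∸ b) C a)
  chooseTwice-comm n a b with a + b ≤? n
  ... | no a+b≰n = trans (chooseTwice-vanishes n a b (≰⇒> a+b≰n))
                         (sym (chooseTwice-vanishes n b a (subst (n <_) (+-comm a b) (≰⇒> a+b≰n))))
  ... | yes a+b≤n = *-cancelʳ-≡ _ _ (a ! * b ! * (n ∸ a ∸ b) !) {{factorials≢0}} (begin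
      ((n C a) * ((n ∸ a) C b)) * (a ! * b ! * (n ∸ a ∸ b) !)  ≡⟨ chooseTwice-factorials n a b a+b≤n ⟩
      n !                                                        ≡⟨ chooseTwice-factorials n b a b+a≤n ⟨
      ((n C b) * ((n ∸ b) C a)) * (b ! * a ! * (n ∸ b ∸ a) !)  ≡⟨ cong ((n C b) * ((n ∸ b) C a) *_) factorials-comm ⟩
      ((n C b) * ((n ∸ b) C a)) * (a ! * b ! * (n ∸ a ∸ b) !)  ∎)
    where
    open ≡-Reasoning
    b+a≤n = subst (_≤ n) (+-comm a b) a+b≤n
    factorials≢0 : NonZero (a ! * b ! * (n ∸ a ∸ b) !)
    factorials≢0 = m*n≢0 (a ! * b !) _ {{a !* b !≢0}} {{(n ∸ a ∸ b) !≢0}}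
    factorials-comm : b ! * a ! * (n ∸ b ∸ a) ! ≡ a ! * b ! * (n ∸ a ∸ b) !
    factorials-comm = cong₂ (λ u v → u * v !) (*-comm (b !) (a !))
                        (trans (∸-+-assoc n b a) (trans (cong (n ∸_) (+-comm b a)) (sym (∸-+-assoc n a b))))

-- The canonical map ℤ → R into any commutative ring is a ring
-- homomorphism; with ℤ as coefficient ring (whose equality is decidable)
-- this instantiates the standard library's ring solver for R.
module IntegerSolver (R : CommutativeRing 0ℓ 0ℓ) where
  open CommutativeRing R
  open import Algebra.Properties.Ring ring using (-0#≈0#; -‿involutive; -‿+-comm; -‿distribˡ-*; -‿distribʳ-*)
  open import Algebra.Properties.CommutativeSemigroup +-commutativeSemigroup using (interchange)
  open SetoidReasoning setoid

  ι : ℕ → Carrier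
  ι = ringFromℕ R

  ι-+ : ∀ m n → ι (m Nat.+ n) ≈ ι m + ι n
  ι-+ zero    n = sym (+-identityˡ _)
  ι-+ (suc m) n = trans (+-congˡ (ι-+ m n)) (sym (+-assoc _ _ _))

  ι-* : ∀ m n → ι (m Nat.* n) ≈ ι m * ι n
  ι-* zero    n = sym (zeroˡ _)
  ι-* (suc m) n = begin
    ι (n Nat.+ m Nat.* n)   ≈⟨ ι-+ n (m Nat.* n) ⟩
    ι n + ι (m Nat.* n)     ≈⟨ +-cong (sym (*-identityˡ _)) (ι-* m n) ⟩
    1# * ι n + ι m * ι n    ≈⟨ distribʳ _ _ _ ⟨
    ι (suc m) * ι n ∎

  ⟦_⟧ : ℤ → Carrier
  ⟦ ℤ.+ n ⟧      = ι n
  ⟦ ℤ.-[1+ n ] ⟧ = - ι (suc n)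

  -‿homo : ∀ i → ⟦ ℤ.- i ⟧ ≈ - ⟦ i ⟧
  -‿homo (ℤ.+ zero)    = sym -0#≈0#
  -‿homo (ℤ.+ suc n)   = refl
  -‿homo ℤ.-[1+ n ]    = sym (-‿involutive _)

  -- the difference of natural numbers, the basic case of integer addition
  ⊖-homo : ∀ m n → ⟦ m ℤ.⊖ n ⟧ ≈ ι m - ι n
  ⊖-homo m zero = begin
    ⟦ m ℤ.⊖ 0 ⟧   ≡⟨ ≡.cong ⟦_⟧ (ℤₚ.⊖-≥ {m} {0} Nat.z≤n) ⟩
    ι m           ≈⟨ +-identityʳ _ ⟨
    ι m + 0#      ≈⟨ +-congˡ -0#≈0# ⟨
    ι m - 0# ∎
  ⊖-homo zero (suc n) = begin
    ⟦ 0 ℤ.⊖ suc n ⟧   ≡⟨ ≡.cong ⟦_⟧ (ℤₚ.⊖-< {0} {suc n} (Nat.s≤s Nat.z≤n)) ⟩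
    - ι (suc n)       ≈⟨ +-identityˡ _ ⟨
    0# - ι (suc n) ∎
  ⊖-homo (suc m) (suc n) = begin
    ⟦ suc m ℤ.⊖ suc n ⟧                   ≡⟨ ≡.cong ⟦_⟧ (ℤₚ.[1+m]⊖[1+n]≡m⊖n m n) ⟩
    ⟦ m ℤ.⊖ n ⟧                           ≈⟨ ⊖-homo m n ⟩
    ι m - ι n                             ≈⟨ +-identityˡ _ ⟨
    0# + (ι m - ι n)                      ≈⟨ +-congʳ (-‿inverseʳ 1#) ⟨
    (1# - 1#) + (ι m - ι n)               ≈⟨ interchange 1# (- 1#) (ι m) (- ι n) ⟩
    (1# + ι m) + (- 1# + - ι n)           ≈⟨ +-congˡ (-‿+-comm 1# (ι n)) ⟩
    ι (suc m) - ι (suc n) ∎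

  +-homo : ∀ i j → ⟦ i ℤ.+ j ⟧ ≈ ⟦ i ⟧ + ⟦ j ⟧
  +-homo ℤ.-[1+ m ] ℤ.-[1+ n ] = begin
    - ι (suc (suc (m Nat.+ n)))      ≡⟨ ≡.cong (λ k → - ι (suc k)) (ℕₚ.+-suc m n) ⟨
    - ι (suc m Nat.+ suc n)          ≈⟨ -‿cong (ι-+ (suc m) (suc n)) ⟩
    - (ι (suc m) + ι (suc n))        ≈⟨ -‿+-comm _ _ ⟨
    - ι (suc m) + - ι (suc n) ∎
  +-homo ℤ.-[1+ m ] (ℤ.+ n)    = trans (⊖-homo n (suc m)) (+-comm _ _)
  +-homo (ℤ.+ m)    ℤ.-[1+ n ] = ⊖-homo m (suc n)
  +-homo (ℤ.+ m)    (ℤ.+ n)    = ι-+ m n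

  signed : Sign → Carrier → Carrier
  signed Sign.+ x = x
  signed Sign.- x = - x

  -- integer multiplication works on sign and absolute value separately
  ◃-homo : ∀ s n → ⟦ s ℤ.◃ n ⟧ ≈ signed s (ι n)
  ◃-homo Sign.+ n = reflexive (≡.cong ⟦_⟧ (ℤₚ.+◃n≡+n n))
  ◃-homo Sign.- n = trans (reflexive (≡.cong ⟦_⟧ (ℤₚ.-◃n≡-n n))) (-‿homo (ℤ.+ n))

  signed-* : ∀ s t x y → signed (s Sign.* t) (x * y) ≈ signed s x * signed t y
  signed-* Sign.+ Sign.+ x y = refl
  signed-* Sign.+ Sign.- x y = -‿distribʳ-* x y
  signed-* Sign.- Sign.+ x y = -‿distribˡ-* x y
  signed-* Sign.- Sign.- x y = begin
    x * y             ≈⟨ -‿involutive _ ⟨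
    - - (x * y)       ≈⟨ -‿cong (-‿distribʳ-* x y) ⟩
    - (x * - y)       ≈⟨ -‿distribˡ-* x (- y) ⟩
    - x * - y ∎

  signed-cong : ∀ s {x y} → x ≈ y → signed s x ≈ signed s y
  signed-cong Sign.+ x≈y = x≈y
  signed-cong Sign.- x≈y = -‿cong x≈y

  signAbs-homo : ∀ i → ⟦ i ⟧ ≈ signed (ℤ.sign i) (ι ℤ.∣ i ∣)
  signAbs-homo (ℤ.+ n)      = refl
  signAbs-homo ℤ.-[1+ n ]   = refl

  *-homo : ∀ i j → ⟦ i ℤ.* j ⟧ ≈ ⟦ i ⟧ * ⟦ j ⟧
  *-homo i j = begin
    ⟦ (ℤ.sign i Sign.* ℤ.sign j) ℤ.◃ (ℤ.∣ i ∣ Nat.* ℤ.∣ j ∣) ⟧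
      ≈⟨ ◃-homo (ℤ.sign i Sign.* ℤ.sign j) (ℤ.∣ i ∣ Nat.* ℤ.∣ j ∣) ⟩
    signed (ℤ.sign i Sign.* ℤ.sign j) (ι (ℤ.∣ i ∣ Nat.* ℤ.∣ j ∣))
      ≈⟨ signed-cong (ℤ.sign i Sign.* ℤ.sign j) (ι-* ℤ.∣ i ∣ ℤ.∣ j ∣) ⟩
    signed (ℤ.sign i Sign.* ℤ.sign j) (ι ℤ.∣ i ∣ * ι ℤ.∣ j ∣)
      ≈⟨ signed-* (ℤ.sign i) (ℤ.sign j) _ _ ⟩
    signed (ℤ.sign i) (ι ℤ.∣ i ∣) * signed (ℤ.sign j) (ι ℤ.∣ j ∣)
      ≈⟨ *-cong (signAbs-homo i) (signAbs-homo j) ⟨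
    ⟦ i ⟧ * ⟦ j ⟧ ∎

  integerMorphism : ℤ.+-*-rawRing -Raw-AlmostCommutative⟶ fromCommutativeRing R
  integerMorphism = record
    { ⟦_⟧ = ⟦_⟧ ; +-homo = +-homo ; *-homo = *-homo ; -‿homo = -‿homo
    ; 0-homo = refl ; 1-homo = +-identityʳ 1# }

  private
    decide : ∀ i j → Maybe (⟦ i ⟧ ≈ ⟦ j ⟧)
    decide i j with i ℤₚ.≟ j
    ... | yes ≡.refl = just refl
    ... | no _       = nothing

  open Algebra.Solver.Ring ℤ.+-*-rawRing (fromCommutativeRing R) integerMorphism decide public
    using (solve; _:=_; _:+_; _:*_; :-_; _:-_; con)

module FieldFacts (K : SubfieldOfℝ) where
  open SubfieldOfℝ K
  open import Algebra.Properties.Ring ring using (-1*x≈-x)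
  open SetoidReasoning setoid
  open Nat using (_∸_; _≤_)
  open Binomial using (C-nonzero; chooseTwice-comm)
  module KSolver = IntegerSolver commutativeRing

  private module Order = IsStrictTotalOrder <-isStrictTotalOrder

  _≟_ : Decidable _≈_
  _≟_ = Order._≟_

  fromℕ-+ : ∀ m n → fromℕ (m Nat.+ n) ≈ fromℕ m + fromℕ n
  fromℕ-+ = KSolver.ι-+

  fromℕ-* : ∀ m n → fromℕ (m Nat.* n) ≈ fromℕ m * fromℕ n
  fromℕ-* = KSolver.ι-*

  fromℕ-1 : fromℕ 1 ≈ 1#
  fromℕ-1 = +-identityʳ 1#

  -- K is ordered with 0 < 1, hence of characteristic 0: fromℕ n ≠ 0 for n ≠ 0
  0<⇒≉0 : ∀ {x} → 0# < x → x ≉ 0#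
  0<⇒≉0 0<x x≈0 = Order.irrefl (sym x≈0) 0<x

  1≉0 : 1# ≉ 0#
  1≉0 = 0<⇒≉0 0<1

  0<fromℕ-suc : ∀ n → 0# < fromℕ (suc n)
  0<fromℕ-suc zero    = proj₁ Order.<-resp-≈ (sym fromℕ-1) 0<1
  0<fromℕ-suc (suc n) = Order.trans (0<fromℕ-suc n)
    (proj₂ Order.<-resp-≈ (+-identityˡ _) (+-mono-< 0# 1# (fromℕ (suc n)) 0<1))

  fromℕ≈0⇒≡0 : ∀ {n} → fromℕ n ≈ 0# → n ≡ 0
  fromℕ≈0⇒≡0 {zero}  _    = ≡.refl
  fromℕ≈0⇒≡0 {suc n} n≈0 = ⊥-elim (0<⇒≉0 (0<fromℕ-suc n) n≈0)

  fromℕ≉0 : ∀ {n} → n ≢ 0 → fromℕ n ≉ 0#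
  fromℕ≉0 n≢0 n≈0 = n≢0 (fromℕ≈0⇒≡0 n≈0)

  inverseˡ : ∀ {x} → x ≉ 0# → x ⁻¹ * x ≈ 1#
  inverseˡ {x} x≉0 = trans (*-comm _ _) (⁻¹-inverse x x≉0)

  zero-product : ∀ x y → x * y ≈ 0# → x ≈ 0# ⊎ y ≈ 0#
  zero-product x y xy≈0 with x ≟ 0#
  ... | yes x≈0 = inj₁ x≈0
  ... | no  x≉0 = inj₂ (begin
    y                  ≈⟨ *-identityˡ y ⟨
    1# * y             ≈⟨ *-congʳ (inverseˡ x≉0) ⟨
    (x ⁻¹ * x) * y     ≈⟨ *-assoc _ _ _ ⟩
    x ⁻¹ * (x * y)     ≈⟨ *-congˡ xy≈0 ⟩
    x ⁻¹ * 0#          ≈⟨ zeroʳ _ ⟩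
    0# ∎)

  *-cancelʳ : ∀ {x y c} → c ≉ 0# → x * c ≈ y * c → x ≈ y
  *-cancelʳ {x} {y} {c} c≉0 xc≈yc = begin
    x                  ≈⟨ *-identityʳ x ⟨
    x * 1#             ≈⟨ *-congˡ (⁻¹-inverse c c≉0) ⟨
    x * (c * c ⁻¹)     ≈⟨ *-assoc _ _ _ ⟨
    (x * c) * c ⁻¹     ≈⟨ *-congʳ xc≈yc ⟩
    (y * c) * c ⁻¹     ≈⟨ *-assoc _ _ _ ⟩
    y * (c * c ⁻¹)     ≈⟨ *-congˡ (⁻¹-inverse c c≉0) ⟩
    y * 1#             ≈⟨ *-identityʳ y ⟩
    y ∎

  sum≤ : ℕ → (ℕ → Carrier) → Carrier
  sum≤ zero    f = f 0
  sum≤ (suc D) f = sum≤ D f + f (suc D)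

  sum≤-cong : ∀ D {f g} → (∀ r → r ≤ D → f r ≈ g r) → sum≤ D f ≈ sum≤ D g
  sum≤-cong zero    f≈g = f≈g 0 Nat.z≤n
  sum≤-cong (suc D) f≈g = +-cong (sum≤-cong D (λ r r≤D → f≈g r (ℕₚ.m≤n⇒m≤1+n r≤D))) (f≈g (suc D) ℕₚ.≤-refl)

  sum≤-+ : ∀ D f g → sum≤ D (λ r → f r + g r) ≈ sum≤ D f + sum≤ D g
  sum≤-+ zero    f g = refl
  sum≤-+ (suc D) f g = trans (+-congʳ (sum≤-+ D f g))
    (KSolver.solve 4 (λ a b c d → (a :+ b) :+ (c :+ d) := (a :+ c) :+ (b :+ d)) refl _ _ _ _)
    where open KSolver using (_:=_; _:+_)

  sum≤-*ˡ : ∀ D c f → sum≤ D (λ r → c * f r) ≈ c * sum≤ D f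
  sum≤-*ˡ zero    c f = refl
  sum≤-*ˡ (suc D) c f = trans (+-congʳ (sum≤-*ˡ D c f)) (sym (distribˡ _ _ _))

  sum≤-*ʳ : ∀ D c f → sum≤ D (λ r → f r * c) ≈ sum≤ D f * c
  sum≤-*ʳ zero    c f = refl
  sum≤-*ʳ (suc D) c f = trans (+-congʳ (sum≤-*ʳ D c f)) (sym (distribʳ _ _ _))

  sum≤-zero : ∀ D {f} → (∀ r → f r ≈ 0#) → sum≤ D f ≈ 0#
  sum≤-zero zero    f≈0 = f≈0 0
  sum≤-zero (suc D) f≈0 = trans (+-cong (sum≤-zero D f≈0) (f≈0 (suc D))) (+-identityˡ 0#)

  sum≤-first : ∀ D f → sum≤ (suc D) f ≈ f 0 + sum≤ D (λ r → f (suc r))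
  sum≤-first zero    f = refl
  sum≤-first (suc D) f = trans (+-congʳ (sum≤-first D f)) (+-assoc _ _ _)

  sgn : ℕ → Carrier
  sgn zero    = 1#
  sgn (suc r) = - sgn r

  sgn-+ : ∀ a b → sgn (a Nat.+ b) ≈ sgn a * sgn b
  sgn-+ zero    b = sym (*-identityˡ _)
  sgn-+ (suc a) b = trans (-‿cong (sgn-+ a b))
    (KSolver.solve 2 (λ x y → :- (x :* y) := (:- x) :* y) refl (sgn a) (sgn b))
    where open KSolver using (_:=_; _:*_; :-_)

  sgn-square : ∀ a → sgn a * sgn a ≈ 1#
  sgn-square zero    = *-identityˡ 1#
  sgn-square (suc a) = trans (KSolver.solve 1 (λ x → (:- x) :* (:- x) := x :* x) refl (sgn a)) (sgn-square a)
    where open KSolver using (_:=_; _:*_; :-_)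

  -- the alternating binomial sum  altSum D c = Σ_{r=0}^{D} (-1)^r C(D,r) c(r),
  -- a D-th forward difference of c up to sign
  altSum : ℕ → (ℕ → Carrier) → Carrier
  altSum D c = sum≤ D (λ r → sgn r * fromℕ (D C r) * c r)

  -- Pascal's rule turns the (D+1)-st difference into a difference of D-th ones.
  altSum-suc : ∀ D c → altSum (suc D) c ≈ altSum D c - altSum D (λ r → c (suc r))
  altSum-suc D c = begin
    altSum (suc D) c
      ≈⟨ sum≤-first D _ ⟩
    first + sum≤ D (λ r → sgn (suc r) * fromℕ (suc D C suc r) * c (suc r))
      ≈⟨ +-congˡ (trans (sum≤-cong D (λ r _ → pascal r)) (sum≤-+ D _ _)) ⟩
    first + (sum≤ D upper + sum≤ D (λ r → - (sgn r * fromℕ (D C r) * c (suc r))))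
      ≈⟨ +-assoc _ _ _ ⟨
    (first + sum≤ D upper) + sum≤ D (λ r → - (sgn r * fromℕ (D C r) * c (suc r)))
      ≈⟨ +-cong (sum≤-first D (λ r → sgn r * fromℕ (D C r) * c r)) (sym negated) ⟨
    (altSum D c + sgn (suc D) * fromℕ (D C suc D) * c (suc D)) - altSum D (λ r → c (suc r))
      ≈⟨ +-congʳ (+-congˡ lastTerm≈0) ⟩
    (altSum D c + 0#) - altSum D (λ r → c (suc r))
      ≈⟨ +-congʳ (+-identityʳ _) ⟩
    altSum D c - altSum D (λ r → c (suc r)) ∎
    where
    open KSolver using (_:=_; _:+_; _:*_; :-_)
    first = sgn 0 * fromℕ (suc D C 0) * c 0
    upper : ℕ → Carrier
    upper r = sgn (suc r) * fromℕ (D C suc r) * c (suc r)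
    pascal : ∀ r → sgn (suc r) * fromℕ (suc D C suc r) * c (suc r)
                   ≈ upper r + - (sgn r * fromℕ (D C r) * c (suc r))
    pascal r = begin
      sgn (suc r) * fromℕ (suc D C suc r) * c (suc r)
        ≡⟨ ≡.cong (λ k → sgn (suc r) * fromℕ k * c (suc r)) (Comb.nCk+nC[k+1]≡[n+1]C[k+1] D r) ⟨
      sgn (suc r) * fromℕ (D C r Nat.+ D C suc r) * c (suc r)
        ≈⟨ *-congʳ (*-congˡ (fromℕ-+ (D C r) (D C suc r))) ⟩
      - sgn r * (fromℕ (D C r) + fromℕ (D C suc r)) * c (suc r)
        ≈⟨ KSolver.solve 4 (λ s a b x → (:- s) :* (a :+ b) :* x := (:- s) :* b :* x :+ :- (s :* a :* x))
             refl (sgn r) (fromℕ (D C r)) (fromℕ (D C suc r)) (c (suc r)) ⟩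
      upper r + - (sgn r * fromℕ (D C r) * c (suc r)) ∎
    negated : sum≤ D (λ r → - (sgn r * fromℕ (D C r) * c (suc r))) ≈ - altSum D (λ r → c (suc r))
    negated = begin
      sum≤ D (λ r → - (sgn r * fromℕ (D C r) * c (suc r)))
        ≈⟨ sum≤-cong D (λ r _ → sym (-1*x≈-x _)) ⟩
      sum≤ D (λ r → - 1# * (sgn r * fromℕ (D C r) * c (suc r)))
        ≈⟨ sum≤-*ˡ D (- 1#) _ ⟩
      - 1# * altSum D (λ r → c (suc r))
        ≈⟨ -1*x≈-x _ ⟩
      - altSum D (λ r → c (suc r)) ∎
    lastTerm≈0 : sgn (suc D) * fromℕ (D C suc D) * c (suc D) ≈ 0#
    lastTerm≈0 = begin
      sgn (suc D) * fromℕ (D C suc D) * c (suc D)  ≡⟨ ≡.cong (λ k → sgn (suc D) * fromℕ k * c (suc D)) (Comb.k>n⇒nCk≡0 (ℕₚ.n<1+n D)) ⟩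
      sgn (suc D) * 0# * c (suc D)                ≈⟨ KSolver.solve 2 (λ s x → s :* KSolver.con (ℤ.+ 0) :* x := KSolver.con (ℤ.+ 0)) refl _ _ ⟩
      0# ∎

  -- The D-th difference of  r ↦ C(M − r, t)  (a polynomial of degree t
  -- in r) is C(M − D, t − D) when D ≤ t, and vanishes when t < D.
  altSum-binomial : ∀ D M t → D ≤ M →
    (D ≤ t → altSum D (λ r → fromℕ ((M ∸ r) C t)) ≈ fromℕ ((M ∸ D) C (t ∸ D)))
    × (t Nat.< D → altSum D (λ r → fromℕ ((M ∸ r) C t)) ≈ 0#)
  altSum-binomial zero M t _ = (λ _ → trans (*-congʳ (trans (*-identityˡ _) fromℕ-1)) (*-identityˡ _)) , λ ()
  altSum-binomial (suc D) (suc M) t (Nat.s≤s D≤M) = aboveDegree , belowDegree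
    where
    previousᴹ⁺¹ = altSum-binomial D (suc M) t (ℕₚ.m≤n⇒m≤1+n D≤M)
    previousᴹ   = altSum-binomial D M t D≤M
    difference : altSum (suc D) (λ r → fromℕ ((suc M ∸ r) C t))
                 ≈ altSum D (λ r → fromℕ ((suc M ∸ r) C t)) - altSum D (λ r → fromℕ ((M ∸ r) C t))
    difference = altSum-suc D _

    aboveDegree : suc D ≤ t → altSum (suc D) (λ r → fromℕ ((suc M ∸ r) C t)) ≈ fromℕ ((M ∸ D) C (t ∸ suc D))
    aboveDegree D<t = begin
      altSum (suc D) (λ r → fromℕ ((suc M ∸ r) C t))
        ≈⟨ difference ⟩
      _ - _
        ≈⟨ +-cong (proj₁ previousᴹ⁺¹ D≤t) (-‿cong (proj₁ previousᴹ D≤t)) ⟩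
      fromℕ ((suc M ∸ D) C (t ∸ D)) - fromℕ ((M ∸ D) C (t ∸ D))
        ≡⟨ ≡.cong₂ (λ a b → fromℕ (a C b) - fromℕ ((M ∸ D) C b)) (ℕₚ.+-∸-assoc 1 D≤M) t∸D≡1+t∸[1+D] ⟩
      fromℕ (suc (M ∸ D) C suc k) - fromℕ ((M ∸ D) C suc k)
        ≡⟨ ≡.cong (λ a → fromℕ a - fromℕ ((M ∸ D) C suc k)) (Comb.nCk+nC[k+1]≡[n+1]C[k+1] (M ∸ D) k) ⟨
      fromℕ ((M ∸ D) C k Nat.+ (M ∸ D) C suc k) - fromℕ ((M ∸ D) C suc k)
        ≈⟨ +-congʳ (fromℕ-+ ((M ∸ D) C k) ((M ∸ D) C suc k)) ⟩
      (fromℕ ((M ∸ D) C k) + fromℕ ((M ∸ D) C suc k)) - fromℕ ((M ∸ D) C suc k)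
        ≈⟨ KSolver.solve 2 (λ a b → (a :+ b) :- b := a) refl _ _ ⟩
      fromℕ ((M ∸ D) C k) ∎
      where
      open KSolver using (_:=_; _:+_; _:-_)
      k = t ∸ suc D
      D≤t = ℕₚ.<⇒≤ D<t
      t∸D≡1+t∸[1+D] : t ∸ D ≡ suc k
      t∸D≡1+t∸[1+D] = ℕₚ.+-∸-assoc 1 D<t

    belowDegree : t Nat.< suc D → altSum (suc D) (λ r → fromℕ ((suc M ∸ r) C t)) ≈ 0#
    belowDegree t<1+D with ℕₚ.m≤n⇒m<n∨m≡n (ℕₚ.≤-pred t<1+D)
    ... | inj₁ t<D = begin
      altSum (suc D) (λ r → fromℕ ((suc M ∸ r) C t))  ≈⟨ difference ⟩
      _ - _                                            ≈⟨ +-cong (proj₂ previousᴹ⁺¹ t<D) (-‿cong (proj₂ previousᴹ t<D)) ⟩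
      0# - 0#                                          ≈⟨ -‿inverseʳ 0# ⟩
      0# ∎
    ... | inj₂ ≡.refl = begin
      altSum (suc D) (λ r → fromℕ ((suc M ∸ r) C t))  ≈⟨ difference ⟩
      _ - _                                            ≈⟨ +-cong (proj₁ previousᴹ⁺¹ ℕₚ.≤-refl) (-‿cong (proj₁ previousᴹ ℕₚ.≤-refl)) ⟩
      fromℕ ((suc M ∸ t) C (t ∸ t)) - fromℕ ((M ∸ t) C (t ∸ t))
        ≡⟨ ≡.cong (λ k → fromℕ ((suc M ∸ t) C k) - fromℕ ((M ∸ t) C k)) (ℕₚ.n∸n≡0 t) ⟩
      fromℕ 1 - fromℕ 1                                 ≈⟨ -‿inverseʳ _ ⟩
      0# ∎

  coefficient : ℕ → ℕ → ℕ → ℕ → Carrier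
  coefficient n d j r = fromℕ (n C (d Nat.+ j Nat.+ 1)) * fromℕ ((d Nat.+ 1) C r)
                        * (fromℕ (n C (j Nat.+ r)) ⁻¹) * sgn (d Nat.+ r)

  -- subset-of-a-subset counting:  C(m,k)·C(m+t,t) = C(m+t,k)·C(m+t−k,t)
  revision : ∀ m t k → fromℕ (m C k) * fromℕ ((m Nat.+ t) C t)
                       ≈ fromℕ ((m Nat.+ t) C k) * fromℕ ((m Nat.+ t ∸ k) C t)
  revision m t k = begin
    fromℕ (m C k) * fromℕ (n C t)           ≈⟨ *-comm _ _ ⟩
    fromℕ (n C t) * fromℕ (m C k)           ≈⟨ fromℕ-* (n C t) (m C k) ⟨
    fromℕ ((n C t) Nat.* (m C k))           ≡⟨ ≡.cong (λ a → fromℕ ((n C t) Nat.* (a C k))) (ℕₚ.m+n∸n≡m m t) ⟨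
    fromℕ ((n C t) Nat.* ((n ∸ t) C k))     ≡⟨ ≡.cong fromℕ (chooseTwice-comm n t k) ⟩
    fromℕ ((n C k) Nat.* ((n ∸ k) C t))     ≈⟨ fromℕ-* (n C k) ((n ∸ k) C t) ⟩
    fromℕ (n C k) * fromℕ ((n ∸ k) C t) ∎
    where n = m Nat.+ t

  -- The (d+1)-st difference of r ↦ C(n−j−r, t) vanishes for t ≤ d;
  -- solved for its last term this reads
  --   C(n−(d+j+1), t) = Σ_{r≤d} (-1)^(d+r) C(d+1,r) C(n−(j+r), t).
  lastTerm : ∀ d j n t → t ≤ d → d Nat.+ j Nat.+ 1 ≤ n →
    fromℕ ((n ∸ (d Nat.+ j Nat.+ 1)) C t)
    ≈ sum≤ d (λ r → sgn (d Nat.+ r) * fromℕ ((d Nat.+ 1) C r) * fromℕ ((n ∸ (j Nat.+ r)) C t))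
  lastTerm d j n t t≤d K≤n = begin
    fromℕ ((n ∸ (d Nat.+ j Nat.+ 1)) C t)      ≡⟨ ≡.cong (λ a → fromℕ (a C t)) N∸[1+d]≡n∸K ⟨
    last                                       ≈⟨ *-identityˡ last ⟨
    1# * last                                  ≈⟨ *-congʳ (sgn-square d) ⟨
    sgn d * sgn d * last                       ≈⟨ *-assoc _ _ _ ⟩
    sgn d * (sgn d * last)                     ≈⟨ *-congˡ partialSum≈ ⟨
    sgn d * sum≤ d g                           ≈⟨ sum≤-*ˡ d (sgn d) g ⟨
    sum≤ d (λ r → sgn d * g r)                 ≈⟨ sum≤-cong d (λ r _ → reindex r) ⟩
    sum≤ d (λ r → sgn (d Nat.+ r) * fromℕ ((d Nat.+ 1) C r) * fromℕ ((n ∸ (j Nat.+ r)) C t)) ∎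
    where
    open KSolver using (_:=_; _:*_; :-_; _:+_)
    j+[1+d]≡K : ∀ d j → j Nat.+ suc d ≡ d Nat.+ j Nat.+ 1
    j+[1+d]≡K = solve-∀
    N = n ∸ j
    last = fromℕ ((N ∸ suc d) C t)
    g : ℕ → Carrier
    g r = sgn r * fromℕ (suc d C r) * fromℕ ((N ∸ r) C t)
    1+d≤N : suc d ≤ N
    1+d≤N = ℕₚ.≤-trans (ℕₚ.≤-reflexive (≡.sym (ℕₚ.m+n∸m≡n j (suc d))))
              (ℕₚ.∸-monoˡ-≤ j (ℕₚ.≤-trans (ℕₚ.≤-reflexive (j+[1+d]≡K d j)) K≤n))
    N∸[1+d]≡n∸K : N ∸ suc d ≡ n ∸ (d Nat.+ j Nat.+ 1)
    N∸[1+d]≡n∸K = ≡.trans (ℕₚ.∸-+-assoc n j (suc d)) (≡.cong (n ∸_) (j+[1+d]≡K d j))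
    vanishing : sum≤ d g + g (suc d) ≈ 0#
    vanishing = proj₂ (altSum-binomial (suc d) N t 1+d≤N) (Nat.s≤s t≤d)
    lastSummand : g (suc d) ≈ - sgn d * last
    lastSummand = *-congʳ (trans (*-congˡ (trans (reflexive (≡.cong fromℕ (Comb.nCn≡1 (suc d)))) fromℕ-1)) (*-identityʳ _))
    partialSum≈ : sum≤ d g ≈ sgn d * last
    partialSum≈ = begin
      sum≤ d g                           ≈⟨ KSolver.solve 2 (λ a b → a := (a :+ b) :+ :- b) refl _ _ ⟩
      (sum≤ d g + g (suc d)) - g (suc d) ≈⟨ +-cong vanishing (-‿cong lastSummand) ⟩
      0# - (- sgn d * last)              ≈⟨ KSolver.solve 2 (λ s c → KSolver.con (ℤ.+ 0) :+ :- ((:- s) :* c) := s :* c) refl _ _ ⟩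
      sgn d * last ∎
    reindex : ∀ r → sgn d * g r ≈ sgn (d Nat.+ r) * fromℕ ((d Nat.+ 1) C r) * fromℕ ((n ∸ (j Nat.+ r)) C t)
    reindex r = begin
      sgn d * (sgn r * fromℕ (suc d C r) * fromℕ ((N ∸ r) C t))
        ≈⟨ KSolver.solve 4 (λ a b c x → a :* (b :* c :* x) := a :* b :* c :* x) refl _ _ _ _ ⟩
      sgn d * sgn r * fromℕ (suc d C r) * fromℕ ((N ∸ r) C t)
        ≈⟨ *-congʳ (*-congʳ (sgn-+ d r)) ⟨
      sgn (d Nat.+ r) * fromℕ (suc d C r) * fromℕ ((N ∸ r) C t)
        ≡⟨ ≡.cong₂ (λ a b → sgn (d Nat.+ r) * fromℕ (a C r) * fromℕ (b C t)) (ℕₚ.+-comm 1 d) (ℕₚ.∸-+-assoc n j r) ⟩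
      sgn (d Nat.+ r) * fromℕ ((d Nat.+ 1) C r) * fromℕ ((n ∸ (j Nat.+ r)) C t) ∎

  -- The identity for m = n − t with t ≤ d and d+j+1 ≤ n: multiply by C(n,t)
  -- and use revision, which turns every C(m,·) into C(n,·) times C(n−·,t).
  binomial-identity-core : ∀ m t d j → t ≤ d → d Nat.+ j Nat.+ 1 ≤ m Nat.+ t →
    fromℕ (m C (d Nat.+ j Nat.+ 1))
    ≈ sum≤ d (λ r → coefficient (m Nat.+ t) d j r * fromℕ (m C (j Nat.+ r)))
  binomial-identity-core m t d j t≤d K≤n = *-cancelʳ cnt≉0 (begin
    fromℕ (m C k) * cnt                                   ≈⟨ revision m t k ⟩
    A * fromℕ ((n ∸ k) C t)                               ≈⟨ *-congˡ (lastTerm d j n t t≤d K≤n) ⟩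
    A * sum≤ d (λ r → sgn (d Nat.+ r) * B r * P r)        ≈⟨ sum≤-*ˡ d A _ ⟨
    sum≤ d (λ r → A * (sgn (d Nat.+ r) * B r * P r))      ≈⟨ sum≤-cong d termwise ⟨
    sum≤ d (λ r → coefficient n d j r * fromℕ (m C (j Nat.+ r)) * cnt)
                                                          ≈⟨ sum≤-*ʳ d cnt _ ⟩
    sum≤ d (λ r → coefficient n d j r * fromℕ (m C (j Nat.+ r))) * cnt ∎)
    where
    n = m Nat.+ t
    k = d Nat.+ j Nat.+ 1
    cnt = fromℕ (n C t)
    cnt≉0 : cnt ≉ 0#
    cnt≉0 = fromℕ≉0 (C-nonzero (ℕₚ.m≤n+m t m))
    A = fromℕ (n C k)
    B : ℕ → Carrier
    B r = fromℕ ((d Nat.+ 1) C r)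
    P : ℕ → Carrier
    P r = fromℕ ((n ∸ (j Nat.+ r)) C t)
    termwise : ∀ r → r ≤ d → coefficient n d j r * fromℕ (m C (j Nat.+ r)) * cnt
                             ≈ A * (sgn (d Nat.+ r) * B r * P r)
    termwise r r≤d = begin
      coefficient n d j r * fromℕ (m C (j Nat.+ r)) * cnt
        ≈⟨ *-assoc _ _ _ ⟩
      coefficient n d j r * (fromℕ (m C (j Nat.+ r)) * cnt)
        ≈⟨ *-congˡ (revision m t (j Nat.+ r)) ⟩
      (A * B r * (Nₖ ⁻¹) * sgn (d Nat.+ r)) * (Nₖ * P r)
        ≈⟨ KSolver.solve 6 (λ a b i s x p → (a :* b :* i :* s) :* (x :* p) := (a :* (s :* b :* p)) :* (i :* x))
             refl A (B r) (Nₖ ⁻¹) (sgn (d Nat.+ r)) Nₖ (P r) ⟩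
      A * (sgn (d Nat.+ r) * B r * P r) * (Nₖ ⁻¹ * Nₖ)
        ≈⟨ *-congˡ (inverseˡ (fromℕ≉0 (C-nonzero j+r≤n))) ⟩
      A * (sgn (d Nat.+ r) * B r * P r) * 1#
        ≈⟨ *-identityʳ _ ⟩
      A * (sgn (d Nat.+ r) * B r * P r) ∎
      where
      open KSolver using (_:=_; _:*_)
      Nₖ = fromℕ (n C (j Nat.+ r))
      j+r≤n : j Nat.+ r ≤ n
      j+r≤n = ℕₚ.≤-trans (ℕₚ.+-monoʳ-≤ j r≤d)
                (ℕₚ.≤-trans (ℕₚ.≤-reflexive (ℕₚ.+-comm j d)) (ℕₚ.≤-trans (ℕₚ.m≤m+n (d Nat.+ j) 1) K≤n))

  binomial-identity : ∀ n m d j → n ∸ d ≤ m → m ≤ n →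
    fromℕ (m C (d Nat.+ j Nat.+ 1)) ≈ sum≤ d (λ r → coefficient n d j r * fromℕ (m C (j Nat.+ r)))
  binomial-identity n m d j n∸d≤m m≤n with d Nat.+ j Nat.+ 1 ℕₚ.≤? n
  ... | yes K≤n = ≡.subst (λ n′ → fromℕ (m C (d Nat.+ j Nat.+ 1)) ≈ sum≤ d (λ r → coefficient n′ d j r * fromℕ (m C (j Nat.+ r))))
                    m+t≡n (binomial-identity-core m (n ∸ m) d j t≤d (ℕₚ.≤-trans K≤n (ℕₚ.≤-reflexive (≡.sym m+t≡n))))
    where
    m+t≡n : m Nat.+ (n ∸ m) ≡ n
    m+t≡n = ℕₚ.m+[n∸m]≡n m≤n
    t≤d : n ∸ m ≤ d
    t≤d with d ℕₚ.≤? n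
    ... | yes d≤n = ℕₚ.≤-trans (ℕₚ.∸-monoʳ-≤ n n∸d≤m) (ℕₚ.≤-reflexive (ℕₚ.m∸[m∸n]≡n d≤n))
    ... | no d≰n  = ℕₚ.≤-trans (ℕₚ.m∸n≤m n m) (ℕₚ.<⇒≤ (ℕₚ.≰⇒> d≰n))
  ... | no K≰n = begin
    fromℕ (m C k)                                 ≡⟨ ≡.cong fromℕ (Comb.k>n⇒nCk≡0 (ℕₚ.≤-<-trans m≤n (ℕₚ.≰⇒> K≰n))) ⟩
    0#                                            ≈⟨ sum≤-zero d vanishes ⟨
    sum≤ d (λ r → coefficient n d j r * fromℕ (m C (j Nat.+ r))) ∎
    where
    open KSolver using (_:=_; _:*_)
    k = d Nat.+ j Nat.+ 1
    vanishes : ∀ r → coefficient n d j r * fromℕ (m C (j Nat.+ r)) ≈ 0#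
    vanishes r = begin
      coefficient n d j r * fromℕ (m C (j Nat.+ r))
        ≡⟨ ≡.cong (λ a → fromℕ a * fromℕ ((d Nat.+ 1) C r) * (fromℕ (n C (j Nat.+ r)) ⁻¹) * sgn (d Nat.+ r) * fromℕ (m C (j Nat.+ r)))
                  (Comb.k>n⇒nCk≡0 (ℕₚ.≰⇒> K≰n)) ⟩
      0# * _ * _ * _ * _
        ≈⟨ KSolver.solve 4 (λ a b c e → KSolver.con (ℤ.+ 0) :* a :* b :* c :* e := KSolver.con (ℤ.+ 0)) refl _ _ _ _ ⟩
      0# ∎

module Counting where
  open Nat using (_≤_)

  count : ∀ {A : Set} → (A → Bool) → List A → ℕ
  count c []      = 0
  count c (y ∷ L) = if c y then suc (count c L) else count c L

  count≡0⇒false : ∀ {A : Set} (c : A → Bool) L {y} → count c L ≡ 0 → y ∈ L → c y ≡ false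
  count≡0⇒false c (y ∷ L) count≡0 (here ≡.refl) with c y
  ... | true  = ⊥-elim (ℕₚ.1+n≢0 count≡0)
  ... | false = ≡.refl
  count≡0⇒false c (z ∷ L) count≡0 (there y∈L) with c z
  ... | true  = ⊥-elim (ℕₚ.1+n≢0 count≡0)
  ... | false = count≡0⇒false c L count≡0 y∈L

  true⇒count≢0 : ∀ {A : Set} (c : A → Bool) L {y} → y ∈ L → c y ≡ true → count c L ≢ 0
  true⇒count≢0 c L y∈L cy≡true count≡0 with ≡.trans (≡.sym (count≡0⇒false c L count≡0 y∈L)) cy≡true
  ... | ()

  false≢true : false ≢ true
  false≢true ()

  countFin : ∀ n → (Fin n → Bool) → ℕ
  countFin zero    c = 0
  countFin (suc n) c = if c Fin.zero then suc (countFin n (c ∘ Fin.suc)) else countFin n (c ∘ Fin.suc)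

  count-tabulate : ∀ {A : Set} n (c : A → Bool) (f : Fin n → A) → count c (List.tabulate f) ≡ countFin n (c ∘ f)
  count-tabulate zero    c f = ≡.refl
  count-tabulate (suc n) c f with c (f Fin.zero)
  ... | true  = ≡.cong suc (count-tabulate n c (f ∘ Fin.suc))
  ... | false = count-tabulate n c (f ∘ Fin.suc)

  countFin≤n : ∀ n c → countFin n c ≤ n
  countFin≤n zero    c = Nat.z≤n
  countFin≤n (suc n) c with c Fin.zero
  ... | true  = Nat.s≤s (countFin≤n n _)
  ... | false = ℕₚ.m≤n⇒m≤1+n (countFin≤n n _)

  enlarge : ∀ n (c : Fin n → Bool) t → countFin n c ≤ t → t ≤ n →
            Σ (Subset n) (λ S → (∀ i → c i ≡ true → i ∈ˢ S) × ∣ S ∣ ≡ t)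
  enlarge zero    c zero    _  _ = [] , (λ ()) , ≡.refl
  enlarge (suc n) c t       c≤t t≤n with c Fin.zero in c₀
  enlarge (suc n) c (suc t) (Nat.s≤s c≤t) (Nat.s≤s t≤n) | true with enlarge n (c ∘ Fin.suc) t c≤t t≤n
  ... | S , c⊆S , ∣S∣≡t = (inside ∷ S) , (λ { Fin.zero _ → _[_]=_.here ; (Fin.suc i) ci → _[_]=_.there (c⊆S i ci) }) , ≡.cong suc ∣S∣≡t
  enlarge (suc n) c t       c≤t t≤1+n     | false with t ℕₚ.≤? n
  ... | yes t≤n with enlarge n (c ∘ Fin.suc) t c≤t t≤n
  ...   | S , c⊆S , ∣S∣≡t = (outside ∷ S) , (λ { Fin.zero c₀′ → ⊥-elim (false≢true (≡.trans (≡.sym c₀) c₀′)) ; (Fin.suc i) ci → _[_]=_.there (c⊆S i ci) }) , ∣S∣≡t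
  enlarge (suc n) c t       c≤t t≤1+n     | false | no t≰n with enlarge n (c ∘ Fin.suc) n (countFin≤n n _) ℕₚ.≤-refl
  ... | S , c⊆S , ∣S∣≡n = (inside ∷ S) , (λ { Fin.zero _ → _[_]=_.here ; (Fin.suc i) ci → _[_]=_.there (c⊆S i ci) }) ,
                          ≡.trans (≡.cong suc ∣S∣≡n) (ℕₚ.≤-antisym (ℕₚ.≰⇒> t≰n) t≤1+n)

module PolynomialRing (K : SubfieldOfℝ) (V : Set) where
  open SubfieldOfℝ K using (Carrier; _≈_; _≉_; 0#; 1#; _⁻¹; ⁻¹-inverse; fromℕ)
    renaming (_+_ to _+ₖ_; _*_ to _*ₖ_; -_ to -ₖ_)
  private module K = SubfieldOfℝ K
  open Poly K V public
  open FieldFacts K using (fromℕ-+; zero-product; 1≉0)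
  open Counting using (count)

  ⊗-idˡ : ∀ p → con 1# ⊗ p ≋ p
  ⊗-idˡ p = ≋-trans (⊗-comm _ _) (⊗-idʳ p)

  polynomialRing : CommutativeRing 0ℓ 0ℓ
  polynomialRing = record
    { Carrier = Expr ; _≈_ = _≋_ ; _+_ = _⊕_ ; _*_ = _⊗_ ; -_ = ⊝_ ; 0# = con 0# ; 1# = con 1#
    ; isCommutativeRing = record
      { isRing = record
        { +-isAbelianGroup = record
          { isGroup = record
            { isMonoid = record
              { isSemigroup = record
                { isMagma = record
                  { isEquivalence = record { refl = ≋-refl ; sym = ≋-sym ; trans = ≋-trans }
                  ; ∙-cong = ⊕-cong }
                ; assoc = ⊕-assoc }
              ; identity = (λ p → ≋-trans (⊕-comm _ _) (⊕-idʳ p)) , ⊕-idʳ }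
            ; inverse = (λ p → ≋-trans (⊕-comm _ _) (⊕-invʳ p)) , ⊕-invʳ
            ; ⁻¹-cong = ⊝-cong }
          ; comm = ⊕-comm }
        ; *-cong = ⊗-cong
        ; *-assoc = ⊗-assoc
        ; *-identity = ⊗-idˡ , ⊗-idʳ
        ; distrib = (λ p q r → ≋-trans (⊗-comm _ _) (≋-trans (distribʳ q r p) (⊕-cong (⊗-comm _ _) (⊗-comm _ _))))
                  , (λ p q r → distribʳ q r p) }
      ; *-comm = ⊗-comm } }

  module ≋Solver = IntegerSolver polynomialRing

  module Quotient (Gen : Expr → Set) where
    I : Expr → Set
    I = InIdeal Gen

    infix 4 _~_
    _~_ : Expr → Expr → Set
    a ~ b = a ≡ b mod Gen

    ideal-neg : ∀ {p} → I p → I (⊝ p)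
    ideal-neg {p} p∈I = resp (-1*x≈-x p) (mul (⊝ con 1#) p∈I)
      where open import Algebra.Properties.Ring (CommutativeRing.ring polynomialRing) using (-1*x≈-x)

    ≋⇒~ : ∀ {a b} → a ≋ b → a ~ b
    ≋⇒~ {a} {b} a≋b = resp (≋-sym (≋-trans (⊕-cong a≋b ≋-refl) (⊕-invʳ b))) zero

    ~-sym : ∀ {a b} → a ~ b → b ~ a
    ~-sym {a} {b} a~b = resp (solve 2 (λ a b → :- (a :- b) := b :- a) ≋-refl a b) (ideal-neg a~b)
      where open ≋Solver

    ~-trans : ∀ {a b c} → a ~ b → b ~ c → a ~ c
    ~-trans {a} {b} {c} a~b b~c = resp (solve 3 (λ a b c → (a :- b) :+ (b :- c) := a :- c) ≋-refl a b c) (add a~b b~c)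
      where open ≋Solver

    ~-⊕ : ∀ {a a′ b b′} → a ~ a′ → b ~ b′ → a ⊕ b ~ a′ ⊕ b′
    ~-⊕ {a} {a′} {b} {b′} a~a′ b~b′ =
      resp (solve 4 (λ a a′ b b′ → (a :- a′) :+ (b :- b′) := (a :+ b) :- (a′ :+ b′)) ≋-refl a a′ b b′) (add a~a′ b~b′)
      where open ≋Solver

    ~-⊗ : ∀ {a a′ b b′} → a ~ a′ → b ~ b′ → a ⊗ b ~ a′ ⊗ b′
    ~-⊗ {a} {a′} {b} {b′} a~a′ b~b′ =
      resp (solve 4 (λ a a′ b b′ → b :* (a :- a′) :+ a′ :* (b :- b′) := a :* b :- a′ :* b′) ≋-refl a a′ b b′)
           (add (mul b a~a′) (mul a′ b~b′))
      where open ≋Solver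

    ~-⊝ : ∀ {a a′} → a ~ a′ → ⊝ a ~ ⊝ a′
    ~-⊝ {a} {a′} a~a′ = resp (solve 2 (λ a a′ → :- (a :- a′) := (:- a) :- (:- a′)) ≋-refl a a′) (ideal-neg a~a′)
      where open ≋Solver

    quotientRing : CommutativeRing 0ℓ 0ℓ
    quotientRing = record
      { Carrier = Expr ; _≈_ = _~_ ; _+_ = _⊕_ ; _*_ = _⊗_ ; -_ = ⊝_ ; 0# = con 0# ; 1# = con 1#
      ; isCommutativeRing = record
        { isRing = record
          { +-isAbelianGroup = record
            { isGroup = record
              { isMonoid = record
                { isSemigroup = record
                  { isMagma = record
                    { isEquivalence = record { refl = ≋⇒~ ≋-refl ; sym = ~-sym ; trans = ~-trans }
                    ; ∙-cong = ~-⊕ }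
                  ; assoc = λ p q r → ≋⇒~ (ℙ.+-assoc p q r) }
                ; identity = (λ p → ≋⇒~ (ℙ.+-identityˡ p)) , (λ p → ≋⇒~ (ℙ.+-identityʳ p)) }
              ; inverse = (λ p → ≋⇒~ (ℙ.-‿inverseˡ p)) , (λ p → ≋⇒~ (ℙ.-‿inverseʳ p))
              ; ⁻¹-cong = ~-⊝ }
            ; comm = λ p q → ≋⇒~ (ℙ.+-comm p q) }
          ; *-cong = ~-⊗
          ; *-assoc = λ p q r → ≋⇒~ (ℙ.*-assoc p q r)
          ; *-identity = (λ p → ≋⇒~ (ℙ.*-identityˡ p)) , (λ p → ≋⇒~ (ℙ.*-identityʳ p))
          ; distrib = (λ p q r → ≋⇒~ (ℙ.distribˡ p q r)) , (λ p q r → ≋⇒~ (ℙ.distribʳ p q r)) }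
        ; *-comm = λ p q → ≋⇒~ (ℙ.*-comm p q) } }
      where module ℙ = CommutativeRing polynomialRing

    module ~Solver = IntegerSolver quotientRing

    p⊖0≋p : ∀ p → p ⊖ con 0# ≋ p
    p⊖0≋p p = ≋-trans (⊕-cong ≋-refl -0#≈0#) (⊕-idʳ p)
      where open import Algebra.Properties.Ring (CommutativeRing.ring polynomialRing) using (-0#≈0#)

    ~0⇒I : ∀ {p} → p ~ con 0# → I p
    ~0⇒I {p} = resp (p⊖0≋p p)

    I⇒~0 : ∀ {p} → I p → p ~ con 0#
    I⇒~0 {p} = resp (≋-sym (p⊖0≋p p))

  bit : Bool → Carrier
  bit true  = 1#
  bit false = 0#

  module Evaluation (α : V → Bool) where
    ev : Expr → Carrier
    ev (con c) = c
    ev (var v) = bit (α v)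
    ev (p ⊕ q) = ev p +ₖ ev q
    ev (p ⊗ q) = ev p *ₖ ev q
    ev (⊝ p)   = -ₖ ev p

    ev-sum-bits : ∀ {A : Set} (F : A → Expr) (c : A → Bool) → (∀ y → ev (F y) ≡ bit (c y)) →
                  ∀ L → ev (Σl (List.map F L)) ≈ fromℕ (count c L)
    ev-sum-bits F c F≡c []      = K.refl
    ev-sum-bits F c F≡c (y ∷ L) with c y | F≡c y
    ... | true  | Fy≡1 = K.+-cong (K.reflexive Fy≡1) (ev-sum-bits F c F≡c L)
    ... | false | Fy≡0 = K.trans (K.+-cong (K.reflexive Fy≡0) (ev-sum-bits F c F≡c L)) (K.+-identityˡ _)

    ev-product≈0 : ∀ {A : Set} (F : A → Expr) L → ev (Πl (List.map F L)) ≈ 0# → Σ A (λ y → y ∈ L × ev (F y) ≈ 0#)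
    ev-product≈0 F []      1≈0 = ⊥-elim (1≉0 1≈0)
    ev-product≈0 F (y ∷ L) prod≈0 with zero-product (ev (F y)) (ev (Πl (List.map F L))) prod≈0
    ... | inj₁ Fy≈0 = y , here ≡.refl , Fy≈0
    ... | inj₂ rest≈0 with ev-product≈0 F L rest≈0
    ...   | z , z∈L , Fz≈0 = z , there z∈L , Fz≈0

    ev-product≉0 : ∀ {A : Set} (F : A → Expr) L → (∀ y → y ∈ L → ev (F y) ≉ 0#) → ev (Πl (List.map F L)) ≉ 0#
    ev-product≉0 F L factors≉0 prod≈0 with ev-product≈0 F L prod≈0
    ... | y , y∈L , Fy≈0 = factors≉0 y y∈L Fy≈0

    ev-product≈1 : ∀ {A : Set} (F : A → Expr) L → (∀ y → ev (F y) ≈ 1#) → ev (Πl (List.map F L)) ≈ 1#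
    ev-product≈1 F []      _     = K.refl
    ev-product≈1 F (y ∷ L) all≈1 = K.trans (K.*-cong (all≈1 y) (ev-product≈1 F L all≈1)) (K.*-identityˡ 1#)

    ev-sum-++ : ∀ ps qs → ev (Σl (ps List.++ qs)) ≈ ev (Σl ps) +ₖ ev (Σl qs)
    ev-sum-++ []       qs = K.sym (K.+-identityˡ _)
    ev-sum-++ (p ∷ ps) qs = K.trans (K.+-congˡ (ev-sum-++ ps qs)) (K.sym (K.+-assoc _ _ _))

    ev-sum-scale : ∀ {A : Set} (e : Expr) (F : A → Expr) L →
                   ev (Σl (List.map (λ y → e ⊗ F y) L)) ≈ ev e *ₖ ev (Σl (List.map F L))
    ev-sum-scale e F []      = K.sym (K.zeroʳ _)
    ev-sum-scale e F (y ∷ L) = K.trans (K.+-congˡ (ev-sum-scale e F L)) (K.sym (K.distribˡ _ _ _))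

    ev-elementary : ∀ {A : Set} (x : A → Expr) (c : A → Bool) → (∀ y → ev (x y) ≡ bit (c y)) →
                    ∀ i L → ev (Σl (List.map (λ S → Πl (List.map x S)) (choose i L))) ≈ fromℕ (count c L C i)
    ev-elementary x c x≡c zero    L       = K.refl
    ev-elementary x c x≡c (suc i) []      = K.refl
    ev-elementary x c x≡c (suc i) (y ∷ L) = begin
      ev (Σl (List.map mono (List.map (y ∷_) (choose i L) List.++ choose (suc i) L)))
        ≡⟨ ≡.cong (ev ∘ Σl) (ListP.map-++ mono (List.map (y ∷_) (choose i L)) (choose (suc i) L)) ⟩
      ev (Σl (List.map mono (List.map (y ∷_) (choose i L)) List.++ List.map mono (choose (suc i) L)))
        ≈⟨ ev-sum-++ (List.map mono (List.map (y ∷_) (choose i L))) (List.map mono (choose (suc i) L)) ⟩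
      ev (Σl (List.map mono (List.map (y ∷_) (choose i L)))) +ₖ ev (Σl (List.map mono (choose (suc i) L)))
        ≡⟨ ≡.cong (λ ps → ev (Σl ps) +ₖ ev (Σl (List.map mono (choose (suc i) L)))) (ListP.map-∘ (choose i L)) ⟨
      ev (Σl (List.map (λ S → x y ⊗ mono S) (choose i L))) +ₖ ev (Σl (List.map mono (choose (suc i) L)))
        ≈⟨ K.+-cong (ev-sum-scale (x y) mono (choose i L)) (ev-elementary x c x≡c (suc i) L) ⟩
      ev (x y) *ₖ ev (Σl (List.map mono (choose i L))) +ₖ fromℕ (count c L C suc i)
        ≈⟨ K.+-congʳ (K.*-cong (K.reflexive (x≡c y)) (ev-elementary x c x≡c i L)) ⟩
      bit (c y) *ₖ fromℕ (count c L C i) +ₖ fromℕ (count c L C suc i)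
        ≈⟨ pascal (c y) ⟩
      fromℕ (count c (y ∷ L) C suc i) ∎
      where
      open SetoidReasoning K.setoid
      mono : List _ → Expr
      mono S = Πl (List.map x S)
      pascal : ∀ b → bit b *ₖ fromℕ (count c L C i) +ₖ fromℕ (count c L C suc i)
                     ≈ fromℕ ((if b then suc (count c L) else count c L) C suc i)
      pascal true  = K.trans (K.+-congʳ (K.*-identityˡ _))
                       (K.trans (K.sym (fromℕ-+ (count c L C i) (count c L C suc i)))
                                (K.reflexive (≡.cong fromℕ (Comb.nCk+nC[k+1]≡[n+1]C[k+1] (count c L) i))))
      pascal false = K.trans (K.+-congʳ (K.zeroˡ _)) (K.+-identityˡ _)

  open Evaluation using (ev)

  -- Ideals containing x_v² − x_v for every variable v are determined by
  -- the Boolean points, through the indicator polynomials.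
  module BooleanPoints (Gen : Expr → Set) (_≟ᵥ_ : DecidableEquality V)
                       (vars : List V) (complete : ∀ v → v ∈ vars)
                       (idempotent : ∀ v → Quotient._~_ Gen (var v ⊗ var v) (var v)) where
    open Quotient Gen
    open import Data.List.Membership.DecPropositional _≟ᵥ_ using (_∈?_)
    module Q = CommutativeRing quotientRing
    open SetoidReasoning Q.setoid

    literal : V → Bool → Expr
    literal v true  = var v
    literal v false = con 1# ⊖ var v

    -- the indicator polynomial of α on the variables in L: it is 1 at α and 0
    -- at every other Boolean point
    indicator : (V → Bool) → List V → Expr
    indicator α []      = con 1#
    indicator α (v ∷ L) = literal v (α v) ⊗ indicator α L

    x[1-x]~0 : ∀ v → var v ⊗ (con 1# ⊖ var v) ~ con 0#
    x[1-x]~0 v = begin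
      var v ⊗ (con 1# ⊖ var v)            ≈⟨ ~Solver.solve 2 (λ x o → x :* (o :- x) := x :* o :- x :* x) Q.refl (var v) (con 1#) ⟩
      var v ⊗ con 1# ⊖ var v ⊗ var v      ≈⟨ Q.+-cong (Q.*-identityʳ _) (Q.-‿cong (idempotent v)) ⟩
      var v ⊖ var v                       ≈⟨ Q.-‿inverseʳ _ ⟩
      con 0# ∎
      where open ~Solver using (_:=_; _:*_; _:-_)

    literal-var : ∀ v b → literal v b ⊗ var v ~ literal v b ⊗ con (bit b)
    literal-var v true  = Q.trans (idempotent v) (Q.sym (Q.*-identityʳ _))
    literal-var v false = begin
      (con 1# ⊖ var v) ⊗ var v      ≈⟨ Q.*-comm _ _ ⟩
      var v ⊗ (con 1# ⊖ var v)      ≈⟨ x[1-x]~0 v ⟩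
      con 0#                        ≈⟨ Q.zeroʳ _ ⟨
      (con 1# ⊖ var v) ⊗ con 0# ∎

    literal-opposite : ∀ v b → literal v b ⊗ literal v (not b) ~ con 0#
    literal-opposite v true  = x[1-x]~0 v
    literal-opposite v false = Q.trans (Q.*-comm _ _) (x[1-x]~0 v)

    indicator-var : ∀ α {L v} → v ∈ L → indicator α L ⊗ var v ~ indicator α L ⊗ con (bit (α v))
    indicator-var α {w ∷ L} {v} (here ≡.refl) = begin
      (literal v (α v) ⊗ indicator α L) ⊗ var v      ≈⟨ swap _ _ _ ⟩
      (literal v (α v) ⊗ var v) ⊗ indicator α L      ≈⟨ Q.*-congʳ (literal-var v (α v)) ⟩
      (literal v (α v) ⊗ con (bit (α v))) ⊗ indicator α L ≈⟨ swap _ _ _ ⟨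
      (literal v (α v) ⊗ indicator α L) ⊗ con (bit (α v)) ∎
      where
      swap : ∀ a b c → (a ⊗ b) ⊗ c ~ (a ⊗ c) ⊗ b
      swap = ~Solver.solve 3 (λ a b c → (a :* b) :* c := (a :* c) :* b) Q.refl
        where open ~Solver using (_:=_; _:*_)
    indicator-var α {w ∷ L} {v} (there v∈L) = begin
      (literal w (α w) ⊗ indicator α L) ⊗ var v                ≈⟨ Q.*-assoc _ _ _ ⟩
      literal w (α w) ⊗ (indicator α L ⊗ var v)                ≈⟨ Q.*-congˡ (indicator-var α v∈L) ⟩
      literal w (α w) ⊗ (indicator α L ⊗ con (bit (α v)))      ≈⟨ Q.*-assoc _ _ _ ⟨
      (literal w (α w) ⊗ indicator α L) ⊗ con (bit (α v)) ∎

    indicator-ev : ∀ α f → indicator α vars ⊗ f ~ indicator α vars ⊗ con (ev α f)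
    indicator-ev α (con c) = Q.refl
    indicator-ev α (var v) = indicator-var α (complete v)
    indicator-ev α (p ⊕ q) = begin
      δ ⊗ (p ⊕ q)                          ≈⟨ Q.distribˡ _ _ _ ⟩
      δ ⊗ p ⊕ δ ⊗ q                        ≈⟨ Q.+-cong (indicator-ev α p) (indicator-ev α q) ⟩
      δ ⊗ con (ev α p) ⊕ δ ⊗ con (ev α q)  ≈⟨ Q.distribˡ _ _ _ ⟨
      δ ⊗ (con (ev α p) ⊕ con (ev α q))    ≈⟨ Q.*-congˡ (≋⇒~ (con-+ _ _)) ⟨
      δ ⊗ con (ev α p +ₖ ev α q) ∎
      where δ = indicator α vars
    indicator-ev α (p ⊗ q) = begin
      δ ⊗ (p ⊗ q)                          ≈⟨ Q.*-assoc _ _ _ ⟨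
      (δ ⊗ p) ⊗ q                          ≈⟨ Q.*-congʳ (indicator-ev α p) ⟩
      (δ ⊗ con (ev α p)) ⊗ q               ≈⟨ ~Solver.solve 3 (λ d c q → (d :* c) :* q := c :* (d :* q)) Q.refl δ _ q ⟩
      con (ev α p) ⊗ (δ ⊗ q)               ≈⟨ Q.*-congˡ (indicator-ev α q) ⟩
      con (ev α p) ⊗ (δ ⊗ con (ev α q))    ≈⟨ ~Solver.solve 3 (λ d c e → c :* (d :* e) := d :* (c :* e)) Q.refl δ _ _ ⟩
      δ ⊗ (con (ev α p) ⊗ con (ev α q))    ≈⟨ Q.*-congˡ (≋⇒~ (con-* _ _)) ⟨
      δ ⊗ con (ev α p *ₖ ev α q) ∎
      where δ = indicator α vars
            open ~Solver using (_:=_; _:*_)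
    indicator-ev α (⊝ p) = begin
      δ ⊗ (⊝ p)                  ≈⟨ -‿distribʳ-* _ _ ⟨
      ⊝ (δ ⊗ p)                  ≈⟨ Q.-‿cong (indicator-ev α p) ⟩
      ⊝ (δ ⊗ con (ev α p))       ≈⟨ -‿distribʳ-* _ _ ⟩
      δ ⊗ (⊝ con (ev α p))       ≈⟨ Q.*-congˡ (≋⇒~ (con-- _)) ⟨
      δ ⊗ con (-ₖ ev α p) ∎
      where δ = indicator α vars
            open import Algebra.Properties.Ring Q.ring using (-‿distribʳ-*)

    indicator-vanishing : ∀ α f → ev α f ≈ 0# → I (indicator α vars ⊗ f)
    indicator-vanishing α f f[α]≈0 = ~0⇒I (begin
      indicator α vars ⊗ f                  ≈⟨ indicator-ev α f ⟩
      indicator α vars ⊗ con (ev α f)       ≈⟨ Q.*-congˡ (≋⇒~ (con-cong f[α]≈0)) ⟩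
      indicator α vars ⊗ con 0#             ≈⟨ Q.zeroʳ _ ⟩
      con 0# ∎)

    indicator-nonvanishing : ∀ α {q} → I q → ev α q ≉ 0# → ∀ f → I (indicator α vars ⊗ f)
    indicator-nonvanishing α {q} q∈I q[α]≉0 f = ~0⇒I (Q.trans (Q.*-congʳ δ~0) (Q.zeroˡ f))
      where
      δ = indicator α vars
      c = ev α q
      δ~0 : δ ~ con 0#
      δ~0 = begin
        δ                            ≈⟨ Q.*-identityʳ δ ⟨
        δ ⊗ con 1#                   ≈⟨ Q.*-congˡ (≋⇒~ (con-cong (⁻¹-inverse c q[α]≉0))) ⟨
        δ ⊗ con (c *ₖ c ⁻¹)           ≈⟨ Q.*-congˡ (≋⇒~ (con-* _ _)) ⟩
        δ ⊗ (con c ⊗ con (c ⁻¹))      ≈⟨ Q.*-assoc _ _ _ ⟨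
        (δ ⊗ con c) ⊗ con (c ⁻¹)      ≈⟨ Q.*-congʳ (indicator-ev α q) ⟨
        (δ ⊗ q) ⊗ con (c ⁻¹)          ≈⟨ Q.*-congʳ (Q.*-congˡ (I⇒~0 q∈I)) ⟩
        (δ ⊗ con 0#) ⊗ con (c ⁻¹)     ≈⟨ Q.trans (Q.*-congʳ (Q.zeroʳ δ)) (Q.zeroˡ _) ⟩
        con 0# ∎

    override : (V → Bool) → V → Bool → V → Bool
    override α v b w with w ≟ᵥ v
    ... | yes _ = b
    ... | no  _ = α w

    override-same : ∀ α v b → override α v b v ≡ b
    override-same α v b with v ≟ᵥ v
    ... | yes _   = ≡.refl
    ... | no  v≢v = ⊥-elim (v≢v ≡.refl)

    override-other : ∀ α v b w → w ≢ v → override α v b w ≡ α w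
    override-other α v b w w≢v with w ≟ᵥ v
    ... | yes w≡v = ⊥-elim (w≢v w≡v)
    ... | no  _   = ≡.refl

    indicator-agree : ∀ α β L → (∀ w → w ∈ L → α w ≡ β w) → indicator α L ≡ indicator β L
    indicator-agree α β []      _     = ≡.refl
    indicator-agree α β (w ∷ L) α≗β =
      ≡.cong₂ (λ b r → literal w b ⊗ r) (α≗β w (here ≡.refl)) (indicator-agree α β L (λ u u∈L → α≗β u (there u∈L)))

    indicator-factor : ∀ α {L v} → v ∈ L → Σ Expr (λ r → indicator α L ~ literal v (α v) ⊗ r)
    indicator-factor α {w ∷ L} (here ≡.refl) = indicator α L , Q.refl
    indicator-factor α {w ∷ L} {v} (there v∈L) with indicator-factor α v∈L
    ... | r , δ~ = literal w (α w) ⊗ r , (begin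
      literal w (α w) ⊗ indicator α L              ≈⟨ Q.*-congˡ δ~ ⟩
      literal w (α w) ⊗ (literal v (α v) ⊗ r)      ≈⟨ ~Solver.solve 3 (λ a b c → a :* (b :* c) := b :* (a :* c)) Q.refl _ _ _ ⟩
      literal v (α v) ⊗ (literal w (α w) ⊗ r) ∎)
      where open ~Solver using (_:=_; _:*_)

    -- The indicators of all Boolean points sum to 1; hence p·f ∈ I as soon
    -- as p · indicator_α(L) · f ∈ I for every α.
    cover : ∀ L p f → (∀ α → I ((p ⊗ indicator α L) ⊗ f)) → I (p ⊗ f)
    cover []      p f hyp = resp (⊗-cong (⊗-idʳ p) ≋-refl) (hyp (λ _ → false))
    cover (v ∷ L) p f hyp = ~0⇒I (begin
      p ⊗ f                                                   ≈⟨ Q.*-congʳ (Q.*-identityʳ p) ⟨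
      (p ⊗ con 1#) ⊗ f                                        ≈⟨ ~Solver.solve 4 (λ p f x o → (p :* o) :* f := (p :* x) :* f :+ (p :* (o :- x)) :* f) Q.refl p f (var v) (con 1#) ⟩
      (p ⊗ literal v true) ⊗ f ⊕ (p ⊗ literal v false) ⊗ f   ≈⟨ Q.+-cong (I⇒~0 (part true)) (I⇒~0 (part false)) ⟩
      con 0# ⊕ con 0#                                         ≈⟨ Q.+-identityʳ _ ⟩
      con 0# ∎)
      where
      open ~Solver using (_:=_; _:*_; _:+_; _:-_)
      part : ∀ b → I ((p ⊗ literal v b) ⊗ f)
      part b = cover L (p ⊗ literal v b) f restricted
        where
        reassoc : ∀ β → I ((p ⊗ indicator β (v ∷ L)) ⊗ f) → I (((p ⊗ literal v (β v)) ⊗ indicator β L) ⊗ f)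
        reassoc β = resp (⊗-cong (≋-sym (⊗-assoc _ _ _)) ≋-refl)
        restricted : ∀ α → I (((p ⊗ literal v b) ⊗ indicator α L) ⊗ f)
        restricted α with v ∈? L | α v Boolₚ.≟ b
        ... | yes _   | yes ≡.refl = reassoc α (hyp α)
        ... | yes v∈L | no αv≢b with indicator-factor α v∈L
        ...   | r , δ~ = ~0⇒I (begin
          ((p ⊗ literal v b) ⊗ indicator α L) ⊗ f               ≈⟨ Q.*-congʳ (Q.*-congˡ δ~) ⟩
          ((p ⊗ literal v b) ⊗ (literal v (α v) ⊗ r)) ⊗ f       ≈⟨ ~Solver.solve 5 (λ p a c r f → ((p :* a) :* (c :* r)) :* f := (a :* c) :* ((p :* r) :* f)) Q.refl p _ _ r f ⟩
          (literal v b ⊗ literal v (α v)) ⊗ ((p ⊗ r) ⊗ f)      ≡⟨ ≡.cong (λ c → (literal v b ⊗ literal v c) ⊗ ((p ⊗ r) ⊗ f)) (Boolₚ.¬-not αv≢b) ⟩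
          (literal v b ⊗ literal v (not b)) ⊗ ((p ⊗ r) ⊗ f)    ≈⟨ Q.*-congʳ (literal-opposite v b) ⟩
          con 0# ⊗ ((p ⊗ r) ⊗ f)                                ≈⟨ Q.zeroˡ _ ⟩
          con 0# ∎)
        restricted α | no v∉L | _ =
          ≡.subst₂ (λ c δ → I (((p ⊗ literal v c) ⊗ δ) ⊗ f)) (override-same α v b)
            (indicator-agree (override α v b) α L (λ w w∈L → override-other α v b w (λ { ≡.refl → v∉L w∈L })))
            (reassoc (override α v b) (hyp (override α v b)))

    boolean-criterion : ∀ f → (∀ α → ev α f ≈ 0# ⊎ Σ Expr (λ q → I q × ev α q ≉ 0#)) → I f
    boolean-criterion f pointwise = resp (⊗-idˡ f) (cover vars (con 1#) f atPoint)
      where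
      atPoint : ∀ α → I ((con 1# ⊗ indicator α vars) ⊗ f)
      atPoint α = resp (⊗-cong (≋-sym (⊗-idˡ _)) ≋-refl) (byCase (pointwise α))
        where
        byCase : ev α f ≈ 0# ⊎ Σ Expr (λ q → I q × ev α q ≉ 0#) → I (indicator α vars ⊗ f)
        byCase (inj₁ f[α]≈0)         = indicator-vanishing α f f[α]≈0
        byCase (inj₂ (q , q∈I , q≉0)) = indicator-nonvanishing α q∈I q≉0 f

module Visibility (K : SubfieldOfℝ) (nG nH : ℕ) (DG : Subset nG) (kG : ℕ)
                  (DH : Subset nH) (kH : ℕ) where
  open SubfieldOfℝ K using (Carrier; _≈_; _≉_; 0#; 1#; fromℕ)
  module K = SubfieldOfℝ K
  open PolynomialRing K (Var nG nH)
  open Viz K nG nH DG kG DH kH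
    using (VizGen; idemG; covG; idemH; covH; idemX; viz; eg; eh; x; σ; sign; coeff; sumTo; rhs)
  open FieldFacts K using (sum≤; sum≤-cong; sgn; coefficient; binomial-identity)

  sign≡sgn : ∀ r → sign r ≡ sgn r
  sign≡sgn zero    = ≡.refl
  sign≡sgn (suc r) = ≡.cong K.-_ (sign≡sgn r)

  ∈elems⁺ : ∀ {n} {S : Subset n} {i} → i ∈ˢ S → i ∈ elems S
  ∈elems⁺ {n} {S} {i} i∈S = ∈-filter⁺ (SubsetP._∈? S) (∈-allFin i) i∈S

  ∈nonElems⁻ : ∀ {n} {S : Subset n} {i} → i ∈ nonElems S → ¬ (i ∈ˢ S)
  ∈nonElems⁻ {n} {S} i∈ = proj₂ (∈-filter⁻ (λ a → ¬? (a SubsetP.∈? S)) {xs = List.allFin n} i∈)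

  indices : Var nG nH → (Fin nG × Fin nG) ⊎ ((Fin nH × Fin nH) ⊎ (Fin nG × Fin nH))
  indices (eG a b _) = inj₁ (a , b)
  indices (eH a b _) = inj₂ (inj₁ (a , b))
  indices (xv g h)   = inj₂ (inj₂ (g , h))

  -- the irrelevant proof of a < b does not distinguish variables
  indices-injective : ∀ {u v} → indices u ≡ indices v → u ≡ v
  indices-injective {eG _ _ _} {eG _ _ _} ≡.refl = ≡.refl
  indices-injective {eH _ _ _} {eH _ _ _} ≡.refl = ≡.refl
  indices-injective {xv _ _}   {xv _ _}   ≡.refl = ≡.refl
  indices-injective {eG _ _ _} {eH _ _ _} ()
  indices-injective {eG _ _ _} {xv _ _}   ()
  indices-injective {eH _ _ _} {eG _ _ _} ()
  indices-injective {eH _ _ _} {xv _ _}   ()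
  indices-injective {xv _ _}   {eG _ _ _} ()
  indices-injective {xv _ _}   {eH _ _ _} ()

  _≟ᵥ_ : DecidableEquality (Var nG nH)
  u ≟ᵥ v = map′ indices-injective (≡.cong indices) (indices u ≟ᵢ indices v)
    where
    _≟ᵢ_ = Sumₚ.≡-dec (Productₚ.≡-dec FinP._≟_ FinP._≟_)
                      (Sumₚ.≡-dec (Productₚ.≡-dec FinP._≟_ FinP._≟_) (Productₚ.≡-dec FinP._≟_ FinP._≟_))

  edgeG : Fin nG → Fin nG → List (Var nG nH)
  edgeG a b with a FinP.<? b
  ... | yes a<b = eG a b a<b ∷ []
  ... | no  _   = []

  edgeH : Fin nH → Fin nH → List (Var nG nH)
  edgeH a b with a FinP.<? b
  ... | yes a<b = eH a b a<b ∷ []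
  ... | no  _   = []

  variablesG variablesH variablesX variables : List (Var nG nH)
  variablesG = List.concat (List.cartesianProductWith edgeG (List.allFin nG) (List.allFin nG))
  variablesH = List.concat (List.cartesianProductWith edgeH (List.allFin nH) (List.allFin nH))
  variablesX = List.cartesianProductWith xv (List.allFin nG) (List.allFin nH)
  variables  = variablesG List.++ variablesH List.++ variablesX

  complete : ∀ v → v ∈ variables
  complete (eG a b a<b) = ∈-++⁺ˡ (∈-concat⁺′ (edge∈ a b a<b) (∈-cartesianProductWith⁺ edgeG (∈-allFin a) (∈-allFin b)))
    where
    edge∈ : ∀ a b .(a<b : a Fin.< b) → eG a b a<b ∈ edgeG a b
    edge∈ a b a<b with a FinP.<? b
    ... | yes _   = here ≡.refl
    ... | no  a≮b = ⊥-elim (a≮b (recompute (a FinP.<? b) a<b))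
  complete (eH a b a<b) = ∈-++⁺ʳ variablesG (∈-++⁺ˡ (∈-concat⁺′ (edge∈ a b a<b) (∈-cartesianProductWith⁺ edgeH (∈-allFin a) (∈-allFin b))))
    where
    edge∈ : ∀ a b .(a<b : a Fin.< b) → eH a b a<b ∈ edgeH a b
    edge∈ a b a<b with a FinP.<? b
    ... | yes _   = here ≡.refl
    ... | no  a≮b = ⊥-elim (a≮b (recompute (a FinP.<? b) a<b))
  complete (xv g h) = ∈-++⁺ʳ variablesG (∈-++⁺ʳ variablesH (∈-cartesianProductWith⁺ xv (∈-allFin g) (∈-allFin h)))

  open Quotient VizGen using (_~_)

  idempotent : ∀ v → var v ⊗ var v ~ var v
  idempotent (eG a b a<b) = gen (idemG a b a<b)
  idempotent (eH a b a<b) = gen (idemH a b a<b)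
  idempotent (xv g h)     = gen (idemX g h)

  open BooleanPoints VizGen _≟ᵥ_ variables complete idempotent using (boolean-criterion) public

  -- A Boolean point α: two graphs on V(G) and V(H), and for each g the
  -- set of vertices of H "seen" from g.
  module AtPoint (α : Var nG nH → Bool) where
    open Evaluation α
    open FieldFacts K using (1≉0; fromℕ≉0; fromℕ≈0⇒≡0; zero-product; _≟_)
    open import Algebra.Properties.Ring K.ring using (-0#≈0#)
    open Counting using (count; countFin; count-tabulate; count≡0⇒false; true⇒count≢0; enlarge; countFin≤n)

    adjacentG : Fin nG → Fin nG → Bool
    adjacentG a b with FinP.<-cmp a b
    ... | tri< a<b _ _ = α (eG a b a<b)
    ... | tri≈ _ _ _   = false
    ... | tri> _ _ b<a = α (eG b a b<a)

    ev-eg : ∀ a b → ev (eg a b) ≡ bit (adjacentG a b)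
    ev-eg a b with FinP.<-cmp a b
    ... | tri< _ _ _ = ≡.refl
    ... | tri≈ _ _ _ = ≡.refl
    ... | tri> _ _ _ = ≡.refl

    adjacentG-irrefl : ∀ a → adjacentG a a ≡ false
    adjacentG-irrefl a with FinP.<-cmp a a
    ... | tri< a<a _ _ = ⊥-elim (FinP.<-irrefl ≡.refl a<a)
    ... | tri≈ _ _ _   = ≡.refl
    ... | tri> _ _ a<a = ⊥-elim (FinP.<-irrefl ≡.refl a<a)

    adjacentH : Fin nH → Fin nH → Bool
    adjacentH a b with FinP.<-cmp a b
    ... | tri< a<b _ _ = α (eH a b a<b)
    ... | tri≈ _ _ _   = false
    ... | tri> _ _ b<a = α (eH b a b<a)

    ev-eh : ∀ a b → ev (eh a b) ≡ bit (adjacentH a b)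
    ev-eh a b with FinP.<-cmp a b
    ... | tri< _ _ _ = ≡.refl
    ... | tri≈ _ _ _ = ≡.refl
    ... | tri> _ _ _ = ≡.refl

    adjacentH-sym : ∀ a b → adjacentH a b ≡ adjacentH b a
    adjacentH-sym a b with FinP.<-cmp a b | FinP.<-cmp b a
    ... | tri< _ _ _   | tri> _ _ _   = ≡.refl
    ... | tri≈ _ _ _   | tri≈ _ _ _   = ≡.refl
    ... | tri> _ _ _   | tri< _ _ _   = ≡.refl
    ... | tri< a<b _ _ | tri< b<a _ _ = ⊥-elim (FinP.<-asym a<b b<a)
    ... | tri< a<b _ _ | tri≈ _ b≡a _ = ⊥-elim (FinP.<-irrefl (≡.sym b≡a) a<b)
    ... | tri≈ _ a≡b _ | tri< b<a _ _ = ⊥-elim (FinP.<-irrefl (≡.sym a≡b) b<a)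
    ... | tri≈ _ a≡b _ | tri> _ _ a<b = ⊥-elim (FinP.<-irrefl a≡b a<b)
    ... | tri> _ _ b<a | tri> _ _ a<b = ⊥-elim (FinP.<-asym a<b b<a)
    ... | tri> _ _ b<a | tri≈ _ b≡a _ = ⊥-elim (FinP.<-irrefl b≡a b<a)

    seen : Fin nG → Fin nH → Bool
    seen g h = α (xv g h)

    #seen : Fin nG → ℕ
    #seen g = countFin nH (seen g)

    ev-σ : ∀ i g → ev (σ i g) ≈ fromℕ (#seen g C i)
    ev-σ i g = K.trans (ev-elementary (x g) (seen g) (λ _ → ≡.refl) i (List.allFin nH))
                       (K.reflexive (≡.cong (λ n → fromℕ (n C i)) (count-tabulate nH (seen g) id)))

    vanishing? : ∀ {n} (F : Fin n → Expr) → (∀ i → ev (F i) ≈ 0#) ⊎ Σ (Fin n) (λ i → ev (F i) ≉ 0#)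
    vanishing? {n} F with FinP.all? (λ i → ev (F i) ≟ 0#)
    ... | yes all≈0 = inj₁ all≈0
    ... | no ¬all≈0 = inj₂ (FinP.¬∀⟶∃¬ n _ (λ i → ev (F i) ≟ 0#) ¬all≈0)

    coverG : Fin nG → Expr
    coverG b = Πl (List.map (λ g′ → Σl (List.map (λ a → eg a g′) (elems (∁ ⁅ b ⁆)))) (nonElems (∁ ⁅ b ⁆)))

    -- This generator evaluates to the number of neighbours of b; so if all of
    -- them vanish, G has no edges at α.
    no-edges : (∀ b → ev (coverG b) ≈ 0#) → ∀ a b → adjacentG a b ≡ false
    no-edges covers a b with ev-product≈0 _ (nonElems (∁ ⁅ b ⁆)) (covers b)
    ... | b′ , b′∈ , sum≈0 = ≡.subst (λ c → adjacentG a c ≡ false) b′≡b noNeighbour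
      where
      b′≡b : b′ ≡ b
      b′≡b = SubsetP.x∈⁅y⁆⇒x≡y b (SubsetP.x∉∁p⇒x∈p (∈nonElems⁻ b′∈))
      count≡0 : count (λ a → adjacentG a b′) (elems (∁ ⁅ b ⁆)) ≡ 0
      count≡0 = fromℕ≈0⇒≡0 (K.trans (K.sym (ev-sum-bits (λ a → eg a b′) (λ a → adjacentG a b′) (λ a → ev-eg a b′) (elems (∁ ⁅ b ⁆)))) sum≈0)
      noNeighbour : adjacentG a b′ ≡ false
      noNeighbour with a FinP.≟ b′
      ... | yes ≡.refl = adjacentG-irrefl a
      ... | no  a≢b′   = count≡0⇒false _ _ count≡0
                           (∈elems⁺ (SubsetP.x∉p⇒x∈∁p (λ a∈⁅b⁆ → a≢b′ (≡.trans (SubsetP.x∈⁅y⁆⇒x≡y b a∈⁅b⁆) (≡.sym b′≡b)))))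

    visibility : Fin nG → Fin nH → Expr
    visibility g h = (one ⊖ x g h)
                     ⊗ Πl (List.map (λ g′ → one ⊖ eg g g′ ⊗ x g′ h) (others g))
                     ⊗ Πl (List.map (λ h′ → one ⊖ eh h h′ ⊗ x g h′) (others h))

    dominated : (∀ a b → adjacentG a b ≡ false) → ∀ g h → ev (visibility g h) ≈ 0# → seen g h ≡ false →
                Σ (Fin nH) (λ h′ → adjacentH h h′ ≡ true × seen g h′ ≡ true)
    dominated noEdges g h vis≈0 unseen
      with zero-product (ev ((one ⊖ x g h) ⊗ Πl (List.map (λ g′ → one ⊖ eg g g′ ⊗ x g′ h) (others g))))
                        (ev (Πl (List.map (λ h′ → one ⊖ eh h h′ ⊗ x g h′) (others h)))) vis≈0
    ... | inj₁ firstFactors≈0 = ⊥-elim (1≉0 (K.trans (K.sym firstFactors≈1) firstFactors≈0))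
      where
      1-0≈1 : 1# K.- 0# ≈ 1#
      1-0≈1 = K.trans (K.+-congˡ -0#≈0#) (K.+-identityʳ 1#)
      unseen≈1 : ev (one ⊖ x g h) ≈ 1#
      unseen≈1 = K.trans (K.reflexive (≡.cong (λ b → 1# K.- bit b) unseen)) 1-0≈1
      noEdge≈1 : ∀ g′ → ev (one ⊖ eg g g′ ⊗ x g′ h) ≈ 1#
      noEdge≈1 g′ = K.trans (K.+-congˡ (K.-‿cong (K.trans (K.*-congʳ (K.reflexive (≡.trans (ev-eg g g′) (≡.cong bit (noEdges g g′)))))
                                                          (K.zeroˡ _))))
                            1-0≈1
      firstFactors≈1 : ev ((one ⊖ x g h) ⊗ Πl (List.map (λ g′ → one ⊖ eg g g′ ⊗ x g′ h) (others g))) ≈ 1#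
      firstFactors≈1 = K.trans (K.*-cong unseen≈1 (ev-product≈1 _ (others g) noEdge≈1)) (K.*-identityˡ 1#)
    ... | inj₂ lastFactor≈0 with ev-product≈0 (λ h′ → one ⊖ eh h h′ ⊗ x g h′) (others h) lastFactor≈0
    ...   | h′ , _ , factor≈0 = h′ , both-true (adjacentH h h′) (seen g h′)
                                       (K.trans (K.+-congˡ (K.-‿cong (K.*-congʳ (K.reflexive (≡.sym (ev-eh h h′)))))) factor≈0)
      where
      both-true : ∀ u w → 1# K.- bit u K.* bit w ≈ 0# → u ≡ true × w ≡ true
      both-true true  true  _    = ≡.refl , ≡.refl
      both-true true  false 1≈0′ = ⊥-elim (1≉0 (K.trans (K.sym (K.trans (K.+-congˡ (K.trans (K.-‿cong (K.zeroʳ _)) -0#≈0#)) (K.+-identityʳ _))) 1≈0′))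
      both-true false w     1≈0′ = ⊥-elim (1≉0 (K.trans (K.sym (K.trans (K.+-congˡ (K.trans (K.-‿cong (K.zeroˡ _)) -0#≈0#)) (K.+-identityʳ _))) 1≈0′))

    coverH : Subset nH → Expr
    coverH S = Πl (List.map (λ h′ → Σl (List.map (λ h → eh h h′) (elems S))) (nonElems S))

    -- The cover generator of H for S evaluates to the product, over h′ ∉ S,
    -- of the number of neighbours of h′ in S: it is non-zero if S dominates H.
    coverH≉0 : ∀ S → (∀ h′ → ¬ (h′ ∈ˢ S) → Σ (Fin nH) (λ h → adjacentH h h′ ≡ true × h ∈ˢ S)) → ev (coverH S) ≉ 0#
    coverH≉0 S dominating = ev-product≉0 _ (nonElems S) neighbours≉0
      where
      neighbours≉0 : ∀ h′ → h′ ∈ nonElems S → ev (Σl (List.map (λ h → eh h h′) (elems S))) ≉ 0#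
      neighbours≉0 h′ h′∈ sum≈0 with dominating h′ (∈nonElems⁻ h′∈)
      ... | h , adjacent , h∈S =
        fromℕ≉0 (true⇒count≢0 (λ h → adjacentH h h′) (elems S) (∈elems⁺ h∈S) adjacent)
                (K.trans (K.sym (ev-sum-bits (λ h → eh h h′) (λ h → adjacentH h h′) (λ h → ev-eh h h′) (elems S))) sum≈0)

    -- If the cover generators of G and the visibility generators of g all
    -- vanish at α, then the vertices seen from g dominate H; extended to a set
    -- of kH − 1 vertices they would make a cover generator of H non-zero.
    many-seen-or-witness : kG ≡ nG → kH Nat.≤ nH → ∀ g →
                           kH Nat.≤ #seen g ⊎ Σ Expr (λ q → VizGen q × ev q ≉ 0#)
    many-seen-or-witness kG≡nG kH≤nH g with vanishing? coverG | vanishing? (visibility g)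
    ... | inj₂ (b , coverG≉0) | _ = inj₂ (coverG b , covG (∁ ⁅ b ⁆) size , coverG≉0)
      where
      size : ∣ ∁ ⁅ b ⁆ ∣ ≡ kG Nat.∸ 1
      size = ≡.trans (SubsetP.∣∁p∣≡n∸∣p∣ ⁅ b ⁆) (≡.cong₂ Nat._∸_ (≡.sym kG≡nG) (SubsetP.∣⁅x⁆∣≡1 b))
    ... | inj₁ _ | inj₂ (h , visibility≉0) = inj₂ (visibility g h , viz g h , visibility≉0)
    ... | inj₁ covers | inj₁ visible with kH ℕₚ.≤? #seen g
    ...   | yes many = inj₁ many
    ...   | no  few with enlarge nH (seen g) (kH Nat.∸ 1) (ℕₚ.suc[m]≤n⇒m≤pred[n] (ℕₚ.≰⇒> few))
                                (ℕₚ.≤-trans (ℕₚ.m∸n≤m kH 1) kH≤nH)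
    ...     | S , seen⊆S , ∣S∣≡kH-1 = inj₂ (coverH S , covH S ∣S∣≡kH-1 , coverH≉0 S dominating)
      where
      dominating : ∀ h′ → ¬ (h′ ∈ˢ S) → Σ (Fin nH) (λ h → adjacentH h h′ ≡ true × h ∈ˢ S)
      dominating h′ h′∉S with dominated (no-edges covers) g h′ (visible h′) unseen
        where
        unseen : seen g h′ ≡ false
        unseen with seen g h′ in eq
        ... | true  = ⊥-elim (h′∉S (seen⊆S h′ eq))
        ... | false = ≡.refl
      ... | h , adjacent , seen-h = h , ≡.trans (adjacentH-sym h h′) adjacent , seen⊆S h seen-h

    ev-sumTo : ∀ D (F : ℕ → Expr) → ev (sumTo D F) ≡ sum≤ D (λ r → ev (F r))
    ev-sumTo zero    F = ≡.refl
    ev-sumTo (suc D) F = ≡.cong (K._+ ev (F (suc D))) (ev-sumTo D F)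

    sides-agree : ∀ d j g → nH Nat.∸ d Nat.≤ #seen g → ev (σ (d Nat.+ j Nat.+ 1) g ⊖ rhs d j g) ≈ 0#
    sides-agree d j g many = begin
      ev (σ (d Nat.+ j Nat.+ 1) g) K.- ev (rhs d j g)
        ≈⟨ K.+-cong (ev-σ (d Nat.+ j Nat.+ 1) g) (K.-‿cong ev-rhs) ⟩
      fromℕ (#seen g C (d Nat.+ j Nat.+ 1)) K.- sum≤ d (λ r → coefficient nH d j r K.* fromℕ (#seen g C (j Nat.+ r)))
        ≈⟨ K.+-congʳ (binomial-identity nH (#seen g) d j many (countFin≤n nH (seen g))) ⟩
      _ K.- _
        ≈⟨ K.-‿inverseʳ _ ⟩
      0# ∎
      where
      open SetoidReasoning K.setoid
      ev-rhs : ev (rhs d j g) ≈ sum≤ d (λ r → coefficient nH d j r K.* fromℕ (#seen g C (j Nat.+ r)))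
      ev-rhs = K.trans (K.reflexive (ev-sumTo d (λ r → con (coeff d j r) ⊗ σ (j Nat.+ r) g)))
                 (sum≤-cong d (λ r _ → K.*-cong (K.reflexive (≡.cong (_ K.*_) (sign≡sgn (d Nat.+ r)))) (ev-σ (j Nat.+ r) g)))

    sides-agree-or-witness : ∀ d → kG ≡ nG → kH ≡ nH Nat.∸ d → ∀ j g →
      ev (σ (d Nat.+ j Nat.+ 1) g ⊖ rhs d j g) ≈ 0# ⊎ Σ Expr (λ q → InIdeal VizGen q × ev q ≉ 0#)
    sides-agree-or-witness d kG≡nG kH≡nH-d j g with many-seen-or-witness kG≡nG kH≤nH g
      where
      kH≤nH : kH Nat.≤ nH
      kH≤nH = ℕₚ.≤-trans (ℕₚ.≤-reflexive kH≡nH-d) (ℕₚ.m∸n≤m nH d)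
    ... | inj₁ many                = inj₁ (sides-agree d j g (≡.subst (Nat._≤ #seen g) kH≡nH-d many))
    ... | inj₂ (q , q-gen , q≉0)   = inj₂ (q , gen q-gen , q≉0)

lemma5p7 : (K : SubfieldOfℝ) (nG nH kG kH d : ℕ) (DG : Subset nG) (DH : Subset nH) →
           ∣ DG ∣ ≡ kG → ∣ DH ∣ ≡ kH →
           kG ≡ nG → 1 Nat.≤ kG → kH ≡ nH Nat.∸ d → 1 Nat.≤ kH → 1 Nat.≤ d →
           (g : Fin nG) (j : ℕ) →
           let open Viz K nG nH DG kG DH kH in
           (σ (d Nat.+ j Nat.+ 1) g ≡ rhs d j g mod VizGen)
lemma5p7 K nG nH kG kH d DG DH _ _ kG≡nG _ kH≡nH-d _ _ g j =
  boolean-criterion (σ (d Nat.+ j Nat.+ 1) g ⊖ rhs d j g)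
                    (λ α → AtPoint.sides-agree-or-witness α d kG≡nG kH≡nH-d j g)
  where
  open Visibility K nG nH DG kG DH kH
  open Viz K nG nH DG kG DH kH using (σ; rhs; _⊖_)
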